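{- Let $M$ be a matroid on a finite ground set $E$ with collection of independent sets $\mathcal{I}$ and collection of bases $\mathcal{B}$, and let $\preceq$ be a total order on $E$. Let $D$ be the diagram obtained from the BDD $\mathsf{B}(\mathcal{B})$ with respect to $(E,\preceq)$ by setting $\nu_0\gets\nu_1$ for every non-terminal node $\nu$ with $\nu_0=\bot$ (i.e., replacing every 0-arc entering the 0-terminal by a copy of the corresponding 1-arc) and then exhaustively applying the BDD reduction rules (NS) and (B-ND). Then $D$ represents $\mathcal{I}$ (so $D=\mathsf{B}(\mathcal{I})$). Likewise, the diagram obtained from the ZDD $\mathsf{Z}(\mathcal{B})$ with respect to $(E,\preceq)$ by setting $\nu_0\gets\nu_1$ for every non-terminal node $\nu$ with $\nu_0=\bot$ represents $\mathcal{I}$, and it already satisfies the ZDD reduction rules (NS) and (Z-ND) immediately after this update (so it equals $\mathsf{Z}(\mathcal{I})$).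
   Context: A decision diagram over $(E,\preceq)$ is a directed acyclic graph with a unique root, at most two terminal nodes, the 0-terminal $\bot$ and the 1-terminal $\top$, and non-terminal nodes $\nu$, each with a label $\ell(\nu)\in E$ and exactly two outgoing arcs, the 0-arc $(\nu,\nu_0)$ and the 1-arc $(\nu,\nu_1)$, with $\ell(\nu)\prec\ell(\nu_0),\ell(\nu_1)$ (terminal labels regarded as larger than all elements of $E$). A 1-path is a directed path from the root to $\top$. Under BDD semantics a 1-path represents all $X\subseteq E$ containing the label of the tail of every 1-arc on the path and no label of the tail of any 0-arc on the path; under ZDD semantics it represents the single set of labels of tails of the 1-arcs on the path; the diagram represents the union. The BDD $\mathsf{B}(\mathcal{S})$ (resp. ZDD $\mathsf{Z}(\mathcal{S})$) of $\mathcal{S}\subseteq 2^E$ is the unique diagram obtained from the complete binary decision tree of $\mathcal{S}$ (internal nodes at depth $j$ labeled by the $(j+1)$-th smallest element of $E$; the leaf reached by taking 1-arcs exactly at the elements of $X$ is $\top$ iff $X\in\mathcal{S}$, else $\bot$) by exhaustively applying: (NS) merge non-terminal nodes with the same label, same 0-successor and same 1-successor; and for BDDs (B-ND) remove every non-terminal $\nu$ with $\nu_0=\nu_1$, redirecting arcs entering $\nu$ to $\nu_0$; for ZDDs (Z-ND) remove every non-terminal $\nu$ with $\nu_1=\bot$, redirecting arcs entering $\nu$ to $\nu_0$. $\mathsf{B}(\mathcal{S})$ (BDD semantics) and $\mathsf{Z}(\mathcal{S})$ (ZDD semantics) represent $\mathcal{S}$. -}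

module Defs where

open import Level using (Level) renaming (suc to lsuc; zero to lzero)
open import Data.Nat using (ℕ; zero; suc; _<_; _<?_)
open import Data.Fin using (Fin; toℕ; fromℕ<)
open import Data.Fin.Subset using (Subset; _∈_; _∉_; _⊆_; ⁅_⁆; _∪_; ∣_∣)
  renaming (⊥ to ∅)
open import Data.Bool using (Bool; true; false; if_then_else_)
import Data.Bool.Properties as BoolP
open import Data.Vec using (Vec; _[_]≔_)
import Data.Vec.Properties as VecP
open import Data.Product using (Σ; _×_; _,_; ∃)
open import Data.Sum using (_⊎_)
open import Relation.Nullary using (¬_; Dec; yes; no; does)
open import Relation.Unary using (Decidable)
open import Relation.Binary.Definitions using (DecidableEquality)
open import Relation.Binary.PropositionalEquality using (_≡_; _≢_; refl; cong; cong₂)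
open import Relation.Binary.Construct.Closure.ReflexiveTransitive using (Star)

-- Ground set: E = Fin n with its natural (total) order.
-- Subsets of E: Subset n.  Families of subsets: decidable predicates.

record Family (n : ℕ) : Set₁ where
  field
    Mem  : Subset n → Set
    mem? : Decidable Mem
open Family public

record Matroid (n : ℕ) : Set₁ where
  field
    Indep      : Subset n → Set
    indep?     : Decidable Indep
    indep-∅    : Indep ∅
    hereditary : ∀ X Y → Y ⊆ X → Indep X → Indep Y
    augment    : ∀ X Y → Indep X → Indep Y → ∣ X ∣ < ∣ Y ∣ →
                 ∃ λ e → e ∈ Y × e ∉ X × Indep (⁅ e ⁆ ∪ X)
open Matroid public

IsBasis : ∀ {n} → Matroid n → Subset n → Set
IsBasis M X = Indep M X × (∀ Y → Indep M Y → X ⊆ Y → Y ≡ X)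

independentSets : ∀ {n} → Matroid n → Family n
independentSets M = record { Mem = Indep M ; mem? = indep? M }

bases : ∀ {n} (M : Matroid n) → Decidable (IsBasis M) → Family n
bases M b? = record { Mem = IsBasis M ; mem? = b? }

-- Decision diagrams (nodes of an arbitrary type with decidable equality;
-- only the part reachable from the root is relevant)

data Kind (N : Set) (n : ℕ) : Set where
  bot   : Kind N n
  top   : Kind N n
  inner : Fin n → N → N → Kind N n          -- label, 0-successor, 1-successor

mapKind : ∀ {N M : Set} {n} → (N → M) → Kind N n → Kind M n
mapKind f bot = bot
mapKind f top = top
mapKind f (inner ℓ a b) = inner ℓ (f a) (f b)

record Diagram (n : ℕ) : Set₁ where
  field
    Node  : Set
    _≟N_  : DecidableEquality Node
    kind  : Node → Kind Node n
    root  : Node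
open Diagram public

data Reach {n} (D : Diagram n) : Node D → Set where
  reach-root : Reach D (root D)
  reach-0    : ∀ {x ℓ a b} → Reach D x → kind D x ≡ inner ℓ a b → Reach D a
  reach-1    : ∀ {x ℓ a b} → Reach D x → kind D x ≡ inner ℓ a b → Reach D b

-- rank of a node (terminals are larger than every element of E)
rank : ∀ {N : Set} {n} → Kind N n → ℕ
rank {n = n} bot = n
rank {n = n} top = n
rank (inner ℓ _ _) = toℕ ℓ

WellFormed : ∀ {n} → Diagram n → Set
WellFormed D =
  (∀ x ℓ a b → Reach D x → kind D x ≡ inner ℓ a b →
     toℕ ℓ < rank (kind D a) × toℕ ℓ < rank (kind D b)) ×
  (∀ x y → Reach D x → Reach D y → kind D x ≡ bot → kind D y ≡ bot → x ≡ y) ×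
  (∀ x y → Reach D x → Reach D y → kind D x ≡ top → kind D y ≡ top → x ≡ y)

data BPath {n} (D : Diagram n) : Node D → Subset n → Subset n → Set where
  end  : ∀ {x} → kind D x ≡ top → BPath D x ∅ ∅
  arc0 : ∀ {x ℓ a b Y Z} → kind D x ≡ inner ℓ a b →
         BPath D a Y Z → BPath D x Y (⁅ ℓ ⁆ ∪ Z)
  arc1 : ∀ {x ℓ a b Y Z} → kind D x ≡ inner ℓ a b →
         BPath D b Y Z → BPath D x (⁅ ℓ ⁆ ∪ Y) Z

BSem : ∀ {n} → Diagram n → Subset n → Set
BSem D X = Σ _ λ Y → Σ _ λ Z →
  BPath D (root D) Y Z × Y ⊆ X × (∀ e → e ∈ Z → e ∉ X)

ZSem : ∀ {n} → Diagram n → Subset n → Set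
ZSem D X = Σ _ λ Z → BPath D (root D) X Z

BRepresents : ∀ {n} → Diagram n → Family n → Set
BRepresents D S = ∀ X → (BSem D X → Mem S X) × (Mem S X → BSem D X)

ZRepresents : ∀ {n} → Diagram n → Family n → Set
ZRepresents D S = ∀ X → (ZSem D X → Mem S X) × (Mem S X → ZSem D X)

-- Internal node  tin j X : depth j (< n), X records the choices made at
-- the first j elements (other entries false); labelled by element j.

data TNode (n : ℕ) : Set where
  tbot ttop : TNode n
  tin       : ℕ → Subset n → TNode n

tnode-≟ : ∀ {n} → DecidableEquality (TNode n)
tnode-≟ tbot tbot = yes refl
tnode-≟ tbot ttop = no λ ()
tnode-≟ tbot (tin _ _) = no λ ()
tnode-≟ ttop tbot = no λ ()
tnode-≟ ttop ttop = yes refl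
tnode-≟ ttop (tin _ _) = no λ ()
tnode-≟ (tin _ _) tbot = no λ ()
tnode-≟ (tin _ _) ttop = no λ ()
tnode-≟ (tin j X) (tin k Y) with Data.Nat._≟_ j k | VecP.≡-dec BoolP._≟_ X Y
... | yes refl | yes refl = yes refl
... | no j≢k   | _        = no λ { refl → j≢k refl }
... | yes _    | no X≢Y   = no λ { refl → X≢Y refl }

nodeAt : ∀ {n} → Family n → ℕ → Subset n → TNode n
nodeAt {n} S j X with j <? n
... | yes _ = tin j X
... | no _  = if does (mem? S X) then ttop else tbot

treeKind : ∀ {n} → Family n → TNode n → Kind (TNode n) n
treeKind S tbot = bot
treeKind S ttop = top
treeKind {n} S (tin j X) with j <? n
... | yes j<n = inner (fromℕ< j<n)
                      (nodeAt S (suc j) (X [ fromℕ< j<n ]≔ false))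
                      (nodeAt S (suc j) (X [ fromℕ< j<n ]≔ true))
... | no _    = bot   -- unreachable junk

completeTree : ∀ {n} → Family n → Diagram n
completeTree {n} S = record
  { Node = TNode n ; _≟N_ = tnode-≟ ; kind = treeKind S ; root = nodeAt S 0 ∅ }

-- Reduction rules.  redirect D v u : every arc entering v (and the root
-- pointer, if it is v) is redirected to u; v thereby disappears from the
-- reachable part.

redirect : ∀ {n} (D : Diagram n) → Node D → Node D → Diagram n
redirect D v u = record
  { Node = Node D ; _≟N_ = _≟N_ D
  ; kind = λ x → mapKind r (kind D x) ; root = r (root D) }
  where
  r : Node D → Node D
  r y = if does (_≟N_ D y v) then u else y

data NSStep {n} (D : Diagram n) : Diagram n → Set₁ where
  ns : ∀ u v ℓ a b → Reach D u → Reach D v → u ≢ v →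
       kind D u ≡ inner ℓ a b → kind D v ≡ inner ℓ a b →
       NSStep D (redirect D v u)

data BNDStep {n} (D : Diagram n) : Diagram n → Set₁ where
  bnd : ∀ ν ℓ a → Reach D ν → kind D ν ≡ inner ℓ a a →
        BNDStep D (redirect D ν a)

data ZNDStep {n} (D : Diagram n) : Diagram n → Set₁ where
  znd : ∀ ν ℓ a b → Reach D ν → kind D ν ≡ inner ℓ a b → kind D b ≡ bot →
        ZNDStep D (redirect D ν a)

data BStep {n} (D D' : Diagram n) : Set₁ where
  step-ns  : NSStep D D' → BStep D D'
  step-bnd : BNDStep D D' → BStep D D'

data ZStep {n} (D D' : Diagram n) : Set₁ where
  step-ns  : NSStep D D' → ZStep D D'
  step-znd : ZNDStep D D' → ZStep D D'

NSFree : ∀ {n} → Diagram n → Set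
NSFree D = ∀ u v ℓ a b → Reach D u → Reach D v →
  kind D u ≡ inner ℓ a b → kind D v ≡ inner ℓ a b → u ≡ v

BNDFree : ∀ {n} → Diagram n → Set
BNDFree D = ∀ ν ℓ a b → Reach D ν → kind D ν ≡ inner ℓ a b → a ≢ b

ZNDFree : ∀ {n} → Diagram n → Set
ZNDFree D = ∀ ν ℓ a b → Reach D ν → kind D ν ≡ inner ℓ a b → kind D b ≢ bot

IsBDDOf : ∀ {n} → Diagram n → Family n → Set₁
IsBDDOf D S = Star BStep (completeTree S) D × NSFree D × BNDFree D

IsZDDOf : ∀ {n} → Diagram n → Family n → Set₁
IsZDDOf D S = Star ZStep (completeTree S) D × NSFree D × ZNDFree D

_≅_ : ∀ {n} → Diagram n → Diagram n → Set
D ≅ D' = Σ (Node D → Node D') λ f →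
  f (root D) ≡ root D' ×
  (∀ x → Reach D x → kind D' (f x) ≡ mapKind f (kind D x)) ×
  (∀ x y → Reach D x → Reach D y → f x ≡ f y → x ≡ y)

updateKind : ∀ {n} (D : Diagram n) → Kind (Node D) n → Kind (Node D) n
updateKind D bot = bot
updateKind D top = top
updateKind D (inner ℓ a b) with kind D a
... | bot = inner ℓ b b
... | _   = inner ℓ a b

update : ∀ {n} → Diagram n → Diagram n
update D = record
  { Node = Node D ; _≟N_ = _≟N_ D
  ; kind = λ x → updateKind D (kind D x) ; root = root D }

module Submission where

-- Write U for the diagram obtained from the decision diagram D₀ of the bases by the update
-- ν₀ ← ν₁ at every node whose 0-arc enters ⊥.  Every set accepted by U is contained in a set
-- accepted by D₀ (follow the same 1-arcs, and take the 1-arc where U took a redirected 0-arc),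
-- i.e. in a basis, hence it is independent.  Conversely, extend an independent X to a basis B
-- and walk down U along X while maintaining a basis B ⊇ X whose path in D₀ passes through the
-- current node.  The only problematic step is a node labelled ℓ with ℓ ∈ B, ℓ ∉ X whose
-- 0-child in D₀ is not ⊥: then some basis B′ runs through the 0-child, and the exchange axiom
-- applied to B ∖ ℓ and B′ yields a basis (B ∖ ℓ) ∪ {f} with f > ℓ that still contains X and
-- now follows the 0-arc.  Both BDD reduction rules
-- preserve the represented family and reduced diagrams are canonical, which gives the BDD
-- statement.  For ZDDs the updated diagram is already reduced: a node ν with ν₀ = ⊥ in Z(ℬ)
-- has ν₁ ≠ ⊥, and if two nodes became equal then one of them would be a node of Z(ℬ) with
-- ν₀ = ν₁, so that two sets differing only in ℓ(ν) would both be bases, contradicting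
-- maximality.

open import Defs
open import Data.Nat using (ℕ; zero; suc; _<_; _≤_; _<?_; _≤?_; z≤n; s≤s; _+_)
import Data.Nat.Properties as NP
open import Data.Fin using (Fin; toℕ; fromℕ<)
import Data.Fin.Properties as FP
open import Data.Fin.Subset using (Subset; _∈_; _∉_; _⊆_; ⁅_⁆; _∪_; ∣_∣) renaming (⊥ to ∅)
import Data.Fin.Subset.Properties as SP
open import Data.Bool using (Bool; true; false; if_then_else_; _∧_; _∨_)
import Data.Bool.Properties as BP
open import Data.Vec using ([]; _∷_; lookup; _[_]≔_; tabulate)
import Data.Vec.Properties as VP
open import Data.Product using (Σ; _×_; _,_; proj₁; proj₂)
open import Data.Sum using (_⊎_; inj₁; inj₂)
open import Data.Empty using (⊥-elim) renaming (⊥ to Empty)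
open import Data.List using (List; []; _∷_; _++_)
import Data.List.Membership.Propositional as LM
import Data.List.Membership.Propositional.Properties as LMP
open import Data.List.Relation.Unary.Any using (here; there)
open import Relation.Nullary using (¬_; Dec; yes; no; does)
open import Relation.Nullary.Decidable using (¬?; _×-dec_; _→-dec_)
open import Relation.Unary using (Decidable)
open import Relation.Binary.Definitions using (tri<; tri≈; tri>)
open import Relation.Binary.PropositionalEquality
  using (_≡_; _≢_; refl; cong; cong₂; sym; trans; subst)
open import Relation.Binary.Construct.Closure.ReflexiveTransitive using (Star; ε; _◅_)

∈⇒lookup : ∀ {n} {X : Subset n} {e} → e ∈ X → lookup X e ≡ true
∈⇒lookup = VP.[]=⇒lookup

lookup⇒∈ : ∀ {n} {X : Subset n} {e} → lookup X e ≡ true → e ∈ X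
lookup⇒∈ {X = X} {e} = VP.lookup⇒[]= e X

∉⇒lookup : ∀ {n} {X : Subset n} {e} → e ∉ X → lookup X e ≡ false
∉⇒lookup {X = X} {e} e∉X with lookup X e in eq
... | true = ⊥-elim (e∉X (lookup⇒∈ eq))
... | false = refl

lookup⇒∉ : ∀ {n} {X : Subset n} {e} → lookup X e ≡ false → e ∉ X
lookup⇒∉ eq e∈X with trans (sym (∈⇒lookup e∈X)) eq
... | ()

bool-clash : ∀ {b : Bool} → b ≡ true → b ≡ false → Empty
bool-clash refl ()

subset-ext : ∀ {n} (X Y : Subset n) → (∀ e → lookup X e ≡ lookup Y e) → X ≡ Y
subset-ext X Y h = trans (sym (VP.tabulate∘lookup X)) (trans (VP.tabulate-cong h) (VP.tabulate∘lookup Y))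

toℕ≢⇒≢ : ∀ {n} {e e' : Fin n} → toℕ e ≢ toℕ e' → e ≢ e'
toℕ≢⇒≢ ne refl = ne refl

lookup-≔ : ∀ {n} (X : Subset n) e b → lookup (X [ e ]≔ b) e ≡ b
lookup-≔ X e b = VP.lookup∘update e X b

lookup-≔-other : ∀ {n} (X : Subset n) {e e'} b → e' ≢ e → lookup (X [ e ]≔ b) e' ≡ lookup X e'
lookup-≔-other X b ne = VP.lookup∘update′ ne X b

lookup-∅ : ∀ {n} (e : Fin n) → lookup ∅ e ≡ false
lookup-∅ e = VP.lookup-replicate e false

AgreeBelow : ∀ {n} → ℕ → Subset n → Subset n → Set
AgreeBelow k X Y = ∀ e → toℕ e < k → lookup X e ≡ lookup Y e

AgreeFrom : ∀ {n} → ℕ → Subset n → Subset n → Set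
AgreeFrom k X Y = ∀ e → k ≤ toℕ e → lookup X e ≡ lookup Y e

spliceAt : ∀ {n} → ℕ → Subset n → Subset n → Fin n → Bool
spliceAt k X Y e with toℕ e <? k
... | yes _ = lookup X e
... | no _ = lookup Y e

splice : ∀ {n} → ℕ → Subset n → Subset n → Subset n
splice k X Y = tabulate (spliceAt k X Y)

splice-below : ∀ {n} k (X Y : Subset n) e → toℕ e < k → lookup (splice k X Y) e ≡ lookup X e
splice-below k X Y e lt rewrite VP.lookup∘tabulate (spliceAt k X Y) e with toℕ e <? k
... | yes _ = refl
... | no ¬lt = ⊥-elim (¬lt lt)

splice-from : ∀ {n} k (X Y : Subset n) e → k ≤ toℕ e → lookup (splice k X Y) e ≡ lookup Y e
splice-from k X Y e le rewrite VP.lookup∘tabulate (spliceAt k X Y) e with toℕ e <? k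
... | yes lt = ⊥-elim (NP.<⇒≱ lt le)
... | no _ = refl

splice-all : ∀ {n} (P X : Subset n) → splice n P X ≡ P
splice-all {n} P X = subset-ext _ _ (λ e → splice-below n P X e (FP.toℕ<n e))

splice-none : ∀ {n} (P X : Subset n) → splice 0 P X ≡ X
splice-none P X = subset-ext _ _ (λ e → splice-from 0 P X e z≤n)

splice-step : ∀ {n} j (P X : Subset n) (lt : j < n) →
  splice (suc j) (P [ fromℕ< lt ]≔ lookup X (fromℕ< lt)) X ≡ splice j P X
splice-step j P X lt = subset-ext _ _ go
  where
  ℓ = fromℕ< lt
  tl : toℕ ℓ ≡ j
  tl = FP.toℕ-fromℕ< lt
  go : ∀ e → lookup (splice (suc j) (P [ ℓ ]≔ lookup X ℓ) X) e ≡ lookup (splice j P X) e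
  go e with NP.<-cmp (toℕ e) j
  ... | tri< lt' _ _ = trans (splice-below (suc j) _ X e (NP.m<n⇒m<1+n lt'))
                        (trans (lookup-≔-other P (lookup X ℓ) (toℕ≢⇒≢ (λ eq → NP.<-irrefl (trans eq tl) lt')))
                               (sym (splice-below j P X e lt')))
  ... | tri≈ _ eq _ with FP.toℕ-injective (trans eq (sym tl))
  ...   | refl = trans (splice-below (suc j) _ X e (s≤s (NP.≤-reflexive eq)))
                  (trans (lookup-≔ P ℓ (lookup X ℓ)) (sym (splice-from j P X e (NP.≤-reflexive (sym eq)))))
  go e | tri> _ _ gt = trans (splice-from (suc j) _ X e gt) (sym (splice-from j P X e (NP.<⇒≤ gt)))

module _ {n : ℕ} where

  lookup-⁅⁆ : ∀ (e : Fin n) → lookup ⁅ e ⁆ e ≡ true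
  lookup-⁅⁆ e = ∈⇒lookup (SP.x∈⁅x⁆ e)

  lookup-⁅⁆-other : ∀ {e e' : Fin n} → e' ≢ e → lookup ⁅ e ⁆ e' ≡ false
  lookup-⁅⁆-other ne = ∉⇒lookup (SP.x≢y⇒x∉⁅y⁆ ne)

  lookup-∪ : ∀ (p q : Subset n) e → lookup (p ∪ q) e ≡ (lookup p e ∨ lookup q e)
  lookup-∪ p q e = VP.lookup-zipWith _∨_ e p q

  ⁅⁆∪≡≔true : ∀ (X : Subset n) e → ⁅ e ⁆ ∪ X ≡ X [ e ]≔ true
  ⁅⁆∪≡≔true X e = subset-ext _ _ pointwise
    where
    pointwise : ∀ e' → lookup (⁅ e ⁆ ∪ X) e' ≡ lookup (X [ e ]≔ true) e'
    pointwise e' with e' FP.≟ e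
    ... | yes refl rewrite lookup-∪ ⁅ e ⁆ X e | lookup-⁅⁆ e | lookup-≔ X e true = refl
    ... | no ne rewrite lookup-∪ ⁅ e ⁆ X e' | lookup-⁅⁆-other ne | lookup-≔-other X true ne = refl

  ⊆-≔false : ∀ {X Y : Subset n} {e} → X ⊆ Y → lookup X e ≡ false → X ⊆ Y [ e ]≔ false
  ⊆-≔false {X} {Y} {e} X⊆Y Xe {e'} e'∈X with e' FP.≟ e
  ... | yes refl = ⊥-elim (bool-clash (∈⇒lookup e'∈X) Xe)
  ... | no ne = lookup⇒∈ (trans (lookup-≔-other Y false ne) (∈⇒lookup (X⊆Y e'∈X)))

  ⊆-≔true : ∀ {X Y : Subset n} {e} → X ⊆ Y → X ⊆ Y [ e ]≔ true
  ⊆-≔true {X} {Y} {e} X⊆Y {e'} e'∈X with e' FP.≟ e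
  ... | yes refl = lookup⇒∈ (lookup-≔ Y e true)
  ... | no ne = lookup⇒∈ (trans (lookup-≔-other Y true ne) (∈⇒lookup (X⊆Y e'∈X)))

  ≔false-⊆ : ∀ (X : Subset n) e → X [ e ]≔ false ⊆ X
  ≔false-⊆ X e {e'} e'∈X₋ with e' FP.≟ e
  ... | yes refl = ⊥-elim (bool-clash (∈⇒lookup e'∈X₋) (lookup-≔ X e false))
  ... | no ne = lookup⇒∈ (trans (sym (lookup-≔-other X false ne)) (∈⇒lookup e'∈X₋))

  ⊆-lookup-false : ∀ {X B : Subset n} {e} → X ⊆ B → lookup B e ≡ false → lookup X e ≡ false
  ⊆-lookup-false {X} {B} {e} X⊆B Be with lookup X e in Xe
  ... | false = refl
  ... | true = ⊥-elim (bool-clash (∈⇒lookup (X⊆B (lookup⇒∈ {X = X} Xe))) Be)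

  card-≔ : ∀ {m} (X : Subset m) e → ∣ X [ e ]≔ true ∣ ≡ suc ∣ X [ e ]≔ false ∣
  card-≔ (x ∷ X) Fin.zero = refl
    where import Data.Fin as Fin
  card-≔ (true ∷ X) (Fin.suc e) = cong suc (card-≔ X e)
    where import Data.Fin as Fin
  card-≔ (false ∷ X) (Fin.suc e) = card-≔ X e
    where import Data.Fin as Fin

  card-remove : ∀ {X : Subset n} {e} → e ∈ X → ∣ X ∣ ≡ suc ∣ X [ e ]≔ false ∣
  card-remove {X} {e} e∈X =
    trans (cong ∣_∣ (sym (trans (cong (X [ e ]≔_) (sym (∈⇒lookup e∈X))) (VP.[]≔-lookup X e))))
          (card-≔ X e)

  card-add : ∀ {X : Subset n} {e} → e ∉ X → ∣ ⁅ e ⁆ ∪ X ∣ ≡ suc ∣ X ∣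
  card-add {X} {e} e∉X =
    trans (cong ∣_∣ (⁅⁆∪≡≔true X e))
      (trans (card-≔ X e)
        (cong (λ z → suc ∣ z ∣) (trans (cong (X [ e ]≔_) (sym (∉⇒lookup e∉X))) (VP.[]≔-lookup X e))))

  ⊂⇒card< : ∀ {X Y : Subset n} → X ⊆ Y → X ≢ Y → ∣ X ∣ < ∣ Y ∣
  ⊂⇒card< {X} {Y} X⊆Y X≢Y with FP.any? (λ e → ¬? (lookup X e BP.≟ lookup Y e))
  ... | yes (e , differ) = SP.p⊂q⇒∣p∣<∣q∣ (X⊆Y , e , witness)
    where
    witness : e ∈ Y × e ∉ X
    witness with lookup X e in Xe | lookup Y e in Ye
    ... | true | _ = ⊥-elim (differ (trans (sym (∈⇒lookup (X⊆Y (lookup⇒∈ Xe)))) Ye))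
    ... | false | true = lookup⇒∈ Ye , lookup⇒∉ Xe
    ... | false | false = ⊥-elim (differ refl)
  ... | no agree = ⊥-elim (X≢Y (subset-ext X Y pointwise))
    where
    pointwise : ∀ e → lookup X e ≡ lookup Y e
    pointwise e with lookup X e BP.≟ lookup Y e
    ... | yes q = q
    ... | no q = ⊥-elim (agree (e , q))

-- Matroids

module MatroidProperties {n : ℕ} (M : Matroid n) where

  basis-maximal : ∀ {B e} → IsBasis M B → e ∉ B → ¬ Indep M (⁅ e ⁆ ∪ B)
  basis-maximal {B} {e} (_ , maximal) e∉B indep =
    e∉B (subst (e ∈_) (maximal _ indep (SP.q⊆p∪q ⁅ e ⁆ B)) (SP.x∈p∪q⁺ (inj₁ (SP.x∈⁅x⁆ e))))

  indep-card≤basis-card : ∀ {B Y} → IsBasis M B → Indep M Y → ∣ Y ∣ ≤ ∣ B ∣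
  indep-card≤basis-card {B} {Y} bB iY with ∣ B ∣ <? ∣ Y ∣
  ... | no ≮ = NP.≮⇒≥ ≮
  ... | yes lt with augment M B Y (proj₁ bB) iY lt
  ...   | e , _ , e∉B , indep = ⊥-elim (basis-maximal bB e∉B indep)

  basis-card : ∀ {B B'} → IsBasis M B → IsBasis M B' → ∣ B ∣ ≡ ∣ B' ∣
  basis-card b b' = NP.≤-antisym (indep-card≤basis-card b' (proj₁ b)) (indep-card≤basis-card b (proj₁ b'))

  card-basis : ∀ {B C} → IsBasis M B → Indep M C → ∣ B ∣ ≤ ∣ C ∣ → IsBasis M C
  card-basis {B} {C} bB iC le = iC , maximal
    where
    maximal : ∀ Y → Indep M Y → C ⊆ Y → Y ≡ C
    maximal Y iY C⊆Y with VP.≡-dec BP._≟_ Y C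
    ... | yes eq = eq
    ... | no ne =
      ⊥-elim (NP.<⇒≱ (NP.≤-<-trans le (⊂⇒card< C⊆Y (λ eq → ne (sym eq)))) (indep-card≤basis-card bB iY))

  -- The budget m bounds the number of proper enlargements still possible.
  extend-to-basis-within : ∀ m X → n ≤ m + ∣ X ∣ → Indep M X →
    Σ (Subset n) λ B → IsBasis M B × X ⊆ B
  extend-to-basis-within m X h iX
    with SP.anySubset? (λ Y → (indep? M Y ×-dec (X SP.⊆? Y)) ×-dec ¬? (VP.≡-dec BP._≟_ Y X))
  ... | no none = X , (iX , maximal) , (λ z → z)
    where
    maximal : ∀ Y → Indep M Y → X ⊆ Y → Y ≡ X
    maximal Y iY X⊆Y with VP.≡-dec BP._≟_ Y X
    ... | yes eq = eq
    ... | no ne = ⊥-elim (none (Y , (iY , X⊆Y) , ne))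
  extend-to-basis-within zero X h iX | yes (Y , (iY , X⊆Y) , ne) =
    ⊥-elim (NP.<⇒≱ (⊂⇒card< X⊆Y (λ eq → ne (sym eq))) (NP.≤-trans (SP.∣p∣≤n Y) h))
  extend-to-basis-within (suc m) X h iX | yes (Y , (iY , X⊆Y) , ne) with extend-to-basis-within m Y h' iY
    where
    h' : n ≤ m + ∣ Y ∣
    h' = NP.≤-trans h (NP.≤-trans (NP.≤-reflexive (sym (NP.+-suc m ∣ X ∣)))
                                  (NP.+-monoʳ-≤ m (⊂⇒card< X⊆Y (λ eq → ne (sym eq)))))
  ... | B , bB , Y⊆B = B , bB , (λ z → Y⊆B (X⊆Y z))

  extend-to-basis : ∀ {X} → Indep M X → Σ (Subset n) λ B → IsBasis M B × X ⊆ B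
  extend-to-basis {X} = extend-to-basis-within n X (NP.m≤m+n n _)

  -- Augmenting B ∖ ℓ from B′ adds some f ∈ B′ ∖ (B ∖ ℓ); since B′ agrees with B below ℓ
  -- and ℓ ∉ B′, this f lies above ℓ.
  exchange-above : ∀ {B B′ ℓ} → IsBasis M B → IsBasis M B′ → ℓ ∈ B → ℓ ∉ B′ →
    (∀ e → toℕ e < toℕ ℓ → lookup B′ e ≡ lookup B e) →
    Σ (Subset n) λ B₂ → IsBasis M B₂ × lookup B₂ ℓ ≡ false × B [ ℓ ]≔ false ⊆ B₂ ×
                        (∀ e → toℕ e < toℕ ℓ → lookup B₂ e ≡ lookup B e)
  exchange-above {B} {B′} {ℓ} bB bB′ ℓ∈B ℓ∉B′ agree
    with augment M (B [ ℓ ]≔ false) B′ (hereditary M B _ (≔false-⊆ B ℓ) (proj₁ bB)) (proj₁ bB′)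
           (subst (∣ B [ ℓ ]≔ false ∣ <_) (trans (sym (card-remove ℓ∈B)) (basis-card bB bB′)) (NP.n<1+n _))
  ... | f , f∈B′ , f∉B₋ , indep = ⁅ f ⁆ ∪ B₋ , basis , ℓ∉B₂ , SP.q⊆p∪q ⁅ f ⁆ B₋ , agree₂
    where
    B₋ = B [ ℓ ]≔ false
    basis : IsBasis M (⁅ f ⁆ ∪ B₋)
    basis = card-basis bB indep (NP.≤-reflexive (trans (card-remove ℓ∈B) (sym (card-add f∉B₋))))
    ℓ<f : toℕ ℓ < toℕ f
    ℓ<f with NP.<-cmp (toℕ f) (toℕ ℓ)
    ... | tri< f<ℓ _ _ = ⊥-elim (f∉B₋ (lookup⇒∈ (trans (lookup-≔-other B false (toℕ≢⇒≢ (NP.<⇒≢ f<ℓ)))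
                                                       (trans (sym (agree f f<ℓ)) (∈⇒lookup f∈B′)))))
    ... | tri≈ _ eq _ = ⊥-elim (ℓ∉B′ (subst (_∈ B′) (FP.toℕ-injective eq) f∈B′))
    ... | tri> _ _ ℓ<f = ℓ<f
    lookup-B₂ : ∀ e → e ≢ f → lookup (⁅ f ⁆ ∪ B₋) e ≡ lookup B₋ e
    lookup-B₂ e ne = trans (lookup-∪ ⁅ f ⁆ B₋ e) (cong (_∨ lookup B₋ e) (lookup-⁅⁆-other ne))
    ℓ∉B₂ : lookup (⁅ f ⁆ ∪ B₋) ℓ ≡ false
    ℓ∉B₂ = trans (lookup-B₂ ℓ (toℕ≢⇒≢ (NP.<⇒≢ ℓ<f))) (lookup-≔ B ℓ false)
    agree₂ : ∀ e → toℕ e < toℕ ℓ → lookup (⁅ f ⁆ ∪ B₋) e ≡ lookup B e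
    agree₂ e e<ℓ = trans (lookup-B₂ e (toℕ≢⇒≢ (NP.<⇒≢ (NP.<-trans e<ℓ ℓ<f))))
                         (lookup-≔-other B false (toℕ≢⇒≢ (NP.<⇒≢ e<ℓ)))

module _ {n : ℕ} where

  rank≤n : ∀ {N : Set} (k : Kind N n) → rank k ≤ n
  rank≤n bot = NP.≤-refl
  rank≤n top = NP.≤-refl
  rank≤n (inner ℓ _ _) = NP.<⇒≤ (FP.toℕ<n ℓ)

  rank-map : ∀ {N M : Set} (f : N → M) (k : Kind N n) → rank (mapKind f k) ≡ rank k
  rank-map f bot = refl
  rank-map f top = refl
  rank-map f (inner ℓ a b) = refl

  inner-injective : ∀ {N : Set} {ℓ ℓ' : Fin n} {a a' b b' : N} →
    _≡_ {A = Kind N n} (inner ℓ a b) (inner ℓ' a' b') → (ℓ ≡ ℓ') × (a ≡ a') × (b ≡ b')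
  inner-injective refl = refl , refl , refl

  inner-unique : ∀ {N : Set} {k : Kind N n} {ℓ ℓ' a a' b b'} → k ≡ inner ℓ a b → k ≡ inner ℓ' a' b' →
    (ℓ ≡ ℓ') × (a ≡ a') × (b ≡ b')
  inner-unique p q = inner-injective (trans (sym p) q)

  top≢inner : ∀ {N : Set} {k : Kind N n} {ℓ a b} → k ≡ top → k ≢ inner ℓ a b
  top≢inner refl ()

  bot≢inner : ∀ {N : Set} {k : Kind N n} {ℓ a b} → k ≡ bot → k ≢ inner ℓ a b
  bot≢inner refl ()

  bot≢top : ∀ {N : Set} {k : Kind N n} → k ≡ bot → k ≢ top
  bot≢top refl ()

  -- Recursions down a diagram carry a budget m with n ≤ m + rank of the current node; ranks
  -- strictly increase along arcs and are at most n, so the budget decreases at every step.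
  budget-step : ∀ {m r r'} → n ≤ suc m + r → r < r' → n ≤ m + r'
  budget-step {m} {r} {r'} h lt =
    NP.≤-trans h (NP.≤-trans (NP.≤-reflexive (sym (NP.+-suc m r))) (NP.+-monoʳ-≤ m lt))

  no-inner-without-budget : ∀ {N : Set} {k : Kind N n} {ℓ a b} → n ≤ 0 + rank k →
    k ≡ inner ℓ a b → Empty
  no-inner-without-budget h refl = NP.<⇒≱ (FP.toℕ<n _) h

  rank-inner : ∀ {N : Set} {k : Kind N n} {ℓ a b} → k ≡ inner ℓ a b → rank k ≡ toℕ ℓ
  rank-inner refl = refl

  inner-rank≤ : ∀ {N : Set} {k : Kind N n} {ℓ a b r} → k ≡ inner ℓ a b → toℕ ℓ < r → rank k ≤ r
  inner-rank≤ k lt = NP.<⇒≤ (subst (_< _) (sym (rank-inner k)) lt)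

  Ordered : Diagram n → Set
  Ordered D = ∀ x ℓ a b → Reach D x → kind D x ≡ inner ℓ a b →
    toℕ ℓ < rank (kind D a) × toℕ ℓ < rank (kind D b)

  ordered : ∀ {D : Diagram n} → WellFormed D → Ordered D
  ordered w = proj₁ w

  bot-unique : ∀ {D : Diagram n} → WellFormed D → ∀ x y → Reach D x → Reach D y →
    kind D x ≡ bot → kind D y ≡ bot → x ≡ y
  bot-unique w = proj₁ (proj₂ w)

  top-unique : ∀ {D : Diagram n} → WellFormed D → ∀ x y → Reach D x → Reach D y →
    kind D x ≡ top → kind D y ≡ top → x ≡ y
  top-unique w = proj₂ (proj₂ w)

  rk : (D : Diagram n) → Node D → ℕ
  rk D x = rank (kind D x)

  kind-view : (D : Diagram n) (x : Node D) → kind D x ≡ top ⊎ kind D x ≡ bot ⊎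
    Σ (Fin n) λ ℓ → Σ (Node D) λ a → Σ (Node D) λ b → kind D x ≡ inner ℓ a b
  kind-view D x with kind D x
  ... | top = inj₁ refl
  ... | bot = inj₂ (inj₁ refl)
  ... | inner ℓ a b = inj₂ (inj₂ (ℓ , a , b , refl))

module _ {n : ℕ} (D : Diagram n) where
  mutual
    reachable : ℕ → Node D → List (Node D)
    reachable zero u = []
    reachable (suc f) u = u ∷ reachableFromKind f (kind D u)

    reachableFromKind : ℕ → Kind (Node D) n → List (Node D)
    reachableFromKind f (inner ℓ a b) = reachable f a ++ reachable f b
    reachableFromKind f _ = []

  reachable-sound : ∀ f {u y} → Reach D u → y LM.∈ reachable f u → Reach D y
  reachable-sound (suc f) {u} r (here refl) = r
  reachable-sound (suc f) {u} r (there m) with kind D u in eq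
  ... | inner ℓ a b with LMP.∈-++⁻ (reachable f a) m
  ...   | inj₁ m' = reachable-sound f (reach-0 r eq) m'
  ...   | inj₂ m' = reachable-sound f (reach-1 r eq) m'

  data PathOfLength : Node D → Node D → ℕ → Set where
    stay : ∀ {u} → PathOfLength u u 0
    step₀ : ∀ {u x ℓ a b d} → kind D u ≡ inner ℓ a b → PathOfLength a x d → PathOfLength u x (suc d)
    step₁ : ∀ {u x ℓ a b d} → kind D u ≡ inner ℓ a b → PathOfLength b x d → PathOfLength u x (suc d)

  snoc₀ : ∀ {u x ℓ a b d} → PathOfLength u x d → kind D x ≡ inner ℓ a b → PathOfLength u a (suc d)
  snoc₀ stay k = step₀ k stay
  snoc₀ (step₀ k' s) k = step₀ k' (snoc₀ s k)
  snoc₀ (step₁ k' s) k = step₁ k' (snoc₀ s k)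

  snoc₁ : ∀ {u x ℓ a b d} → PathOfLength u x d → kind D x ≡ inner ℓ a b → PathOfLength u b (suc d)
  snoc₁ stay k = step₁ k stay
  snoc₁ (step₀ k' s) k = step₀ k' (snoc₁ s k)
  snoc₁ (step₁ k' s) k = step₁ k' (snoc₁ s k)

  reach⇒path : Ordered D → ∀ {x} → Reach D x → Σ ℕ λ d → PathOfLength (root D) x d × d ≤ rk D x
  reach⇒path o reach-root = 0 , stay , z≤n
  reach⇒path o (reach-0 {x} r k) with reach⇒path o r
  ... | d , s , le = suc d , snoc₀ s k ,
        NP.≤-trans (s≤s (NP.≤-trans le (NP.≤-reflexive (rank-inner k)))) (proj₁ (o _ _ _ _ r k))
  reach⇒path o (reach-1 {x} r k) with reach⇒path o r
  ... | d , s , le = suc d , snoc₁ s k ,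
        NP.≤-trans (s≤s (NP.≤-trans le (NP.≤-reflexive (rank-inner k)))) (proj₂ (o _ _ _ _ r k))

  path⇒∈reachable : ∀ {u x d} f → PathOfLength u x d → d < f → x LM.∈ reachable f u
  path⇒∈reachable (suc f) stay lt = here refl
  path⇒∈reachable {u} (suc f) (step₀ {a = a} {b} k s) (s≤s lt) =
    there (subst (λ z → _ LM.∈ reachableFromKind f z) (sym k) (LMP.∈-++⁺ˡ (path⇒∈reachable f s lt)))
  path⇒∈reachable {u} (suc f) (step₁ {a = a} {b} k s) (s≤s lt) =
    there (subst (λ z → _ LM.∈ reachableFromKind f z) (sym k)
                 (LMP.∈-++⁺ʳ (reachable f a) (path⇒∈reachable f s lt)))

  reach⇒∈reachable : Ordered D → ∀ {x} → Reach D x → x LM.∈ reachable (suc n) (root D)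
  reach⇒∈reachable o r with reach⇒path o r
  ... | d , s , le = path⇒∈reachable (suc n) s (s≤s (NP.≤-trans le (rank≤n (kind D _))))

find : ∀ {A : Set} (P : A → Set) → Decidable P → List A → A → A
find P d [] def = def
find P d (y ∷ ys) def with d y
... | yes _ = y
... | no _ = find P d ys def

find-sound : ∀ {A : Set} (P : A → Set) (d : Decidable P) xs def {y} → y LM.∈ xs → P y →
          (find P d xs def LM.∈ xs) × P (find P d xs def)
find-sound P d (z ∷ zs) def m p with d z
... | yes q = here refl , q
find-sound P d (z ∷ zs) def (here refl) p | no ¬q = ⊥-elim (¬q p)
find-sound P d (z ∷ zs) def (there m) p | no ¬q with find-sound P d zs def m p
... | m' , q = there m' , q

-- Canonicity

-- Two diagrams whose nodes have a semantics (with a decision procedure ev for it): if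
-- equivalent nodes have the same shape and equivalent nodes of one diagram are equal, then
-- sending x to the first reachable node of D′ equivalent to x is an isomorphism.
module Canonical {n : ℕ}
  (Sem : (E : Diagram n) → Node E → Subset n → Set)
  (ev : (E : Diagram n) → Node E → Subset n → Bool)
  (D D' : Diagram n)
  where

  Equivalent : (E1 : Diagram n) → Node E1 → (E2 : Diagram n) → Node E2 → Set
  Equivalent E1 x E2 y = ∀ X → (Sem E1 x X → Sem E2 y X) × (Sem E2 y X → Sem E1 x X)

  SameShape : Node D → Node D' → Set
  SameShape x y = (kind D x ≡ top → kind D' y ≡ top) × (kind D x ≡ bot → kind D' y ≡ bot) ×
    (∀ ℓ a b → kind D x ≡ inner ℓ a b → Σ (Node D') λ c → Σ (Node D') λ d →
      kind D' y ≡ inner ℓ c d × Equivalent D a D' c × Equivalent D b D' d)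

  module Construction
    (evD-correct : ∀ {u} X → Reach D u →
      (ev D u X ≡ true → Sem D u X) × (Sem D u X → ev D u X ≡ true))
    (evD'-correct : ∀ {u} X → Reach D' u →
      (ev D' u X ≡ true → Sem D' u X) × (Sem D' u X → ev D' u X ≡ true))
    (ordD' : Ordered D')
    (shape : ∀ x y → Reach D x → Reach D' y → Equivalent D x D' y → SameShape x y)
    (uniqueD : ∀ x x' → Reach D x → Reach D x' → Equivalent D x D x' → x ≡ x')
    (uniqueD' : ∀ y y' → Reach D' y → Reach D' y' → Equivalent D' y D' y' → y ≡ y')
    (rootEquivalent : Equivalent D (root D) D' (root D'))
    where

    Match : Node D → Node D' → Set
    Match x y = ∀ X → ev D x X ≡ ev D' y X

    decMatch : ∀ x y → Dec (Match x y)
    decMatch x y with SP.anySubset? (λ X → ¬? (ev D x X BP.≟ ev D' y X))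
    ... | yes (X , ne) = no (λ m → ne (m X))
    ... | no h = yes λ X → helper X
      where
      helper : ∀ X → ev D x X ≡ ev D' y X
      helper X with ev D x X BP.≟ ev D' y X
      ... | yes e = e
      ... | no ne = ⊥-elim (h (X , ne))

    equivalent⇒match : ∀ {x y} → Reach D x → Reach D' y → Equivalent D x D' y → Match x y
    equivalent⇒match {x} {y} rx ry se X with ev D x X in e1 | ev D' y X in e2
    ... | true | true = refl
    ... | false | false = refl
    ... | true | false =
      ⊥-elim (bool-clash (proj₂ (evD'-correct X ry) (proj₁ (se X) (proj₁ (evD-correct X rx) e1))) e2)
    ... | false | true =
      ⊥-elim (bool-clash (proj₂ (evD-correct X rx) (proj₂ (se X) (proj₁ (evD'-correct X ry) e2))) e1)

    match⇒equivalent : ∀ {x y} → Reach D x → Reach D' y → Match x y → Equivalent D x D' y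
    match⇒equivalent rx ry m X =
      (λ s → proj₁ (evD'-correct X ry) (trans (sym (m X)) (proj₂ (evD-correct X rx) s))) ,
      (λ s → proj₁ (evD-correct X rx) (trans (m X) (proj₂ (evD'-correct X ry) s)))

    equivalent-sym : ∀ {E1 E2 x y} → Equivalent E1 x E2 y → Equivalent E2 y E1 x
    equivalent-sym s X = proj₂ (s X) , proj₁ (s X)

    equivalent-trans : ∀ {E1 E2 E3 x y z} → Equivalent E1 x E2 y → Equivalent E2 y E3 z → Equivalent E1 x E3 z
    equivalent-trans s t X = (λ p → proj₁ (t X) (proj₁ (s X) p)) , (λ p → proj₂ (s X) (proj₂ (t X) p))

    counterpart : ∀ {x} → Reach D x → Σ (Node D') λ y → Reach D' y × Equivalent D x D' y
    counterpart reach-root = root D' , reach-root , rootEquivalent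
    counterpart (reach-0 {x} {ℓ} {a} {b} r k) with counterpart r
    ... | y , ry , se with proj₂ (proj₂ (shape _ _ r ry se)) ℓ a b k
    ...   | c , d , k' , sa , sb = c , reach-0 ry k' , sa
    counterpart (reach-1 {x} {ℓ} {a} {b} r k) with counterpart r
    ... | y , ry , se with proj₂ (proj₂ (shape _ _ r ry se)) ℓ a b k
    ...   | c , d , k' , sa , sb = d , reach-1 ry k' , sb

    candidates : List (Node D')
    candidates = reachable D' (suc n) (root D')

    f : Node D → Node D'
    f x = find (Match x) (decMatch x) candidates (root D')

    f-counterpart : ∀ {x} → Reach D x → Reach D' (f x) × Equivalent D x D' (f x)
    f-counterpart {x} r with counterpart r
    ... | y , ry , se
      with find-sound (Match x) (decMatch x) candidates (root D') (reach⇒∈reachable D' ordD' ry)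
                      (equivalent⇒match r ry se)
    ...   | m , mt = rf , match⇒equivalent r rf mt
      where rf = reachable-sound D' (suc n) reach-root m

    iso : D ≅ D'
    iso = f , f-root , f-kind , f-injective
      where
      f-root : f (root D) ≡ root D'
      f-root = uniqueD' _ _ (proj₁ (f-counterpart reach-root)) reach-root
                (equivalent-trans (equivalent-sym (proj₂ (f-counterpart reach-root))) rootEquivalent)

      f-kind : ∀ x → Reach D x → kind D' (f x) ≡ mapKind f (kind D x)
      f-kind x r with kind D x in k
      ... | top = proj₁ (shape _ _ r (proj₁ (f-counterpart r)) (proj₂ (f-counterpart r))) k
      ... | bot = proj₁ (proj₂ (shape _ _ r (proj₁ (f-counterpart r)) (proj₂ (f-counterpart r)))) k
      ... | inner ℓ a b with proj₂ (proj₂ (shape _ _ r (proj₁ (f-counterpart r)) (proj₂ (f-counterpart r)))) ℓ a b k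
      ...   | c , d , k' , sa , sb =
        trans k' (cong₂ (inner ℓ)
          (uniqueD' _ _ (reach-0 (proj₁ (f-counterpart r)) k') (proj₁ (f-counterpart ra))
                    (equivalent-trans (equivalent-sym sa) (proj₂ (f-counterpart ra))))
          (uniqueD' _ _ (reach-1 (proj₁ (f-counterpart r)) k') (proj₁ (f-counterpart rb))
                    (equivalent-trans (equivalent-sym sb) (proj₂ (f-counterpart rb)))))
        where ra = reach-0 r k
              rb = reach-1 r k

      f-injective : ∀ x y → Reach D x → Reach D y → f x ≡ f y → x ≡ y
      f-injective x y rx ry e = uniqueD _ _ rx ry
        (equivalent-trans (proj₂ (f-counterpart rx))
          (subst (λ z → Equivalent D' z D y) (sym e) (equivalent-sym (proj₂ (f-counterpart ry)))))

module UniqueUpToEquivalence {n : ℕ}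
  (Sem : (E : Diagram n) → Node E → Subset n → Set)
  (D : Diagram n) (wf : WellFormed D) (nsf : NSFree D)
  where
  open Canonical Sem (λ _ _ _ → true) D D using (Equivalent; SameShape)

  ShapeWithin : ℕ → Set
  ShapeWithin m = ∀ x y → Reach D x → Reach D y → n ≤ m + rk D x → n ≤ m + rk D y →
    Equivalent D x D y → SameShape x y

  equivalent⇒equal : ∀ m → ShapeWithin m → ∀ x y → Reach D x → Reach D y →
    n ≤ m + rk D x → n ≤ m + rk D y → Equivalent D x D y → x ≡ y
  equivalent⇒equal m st x y rx ry hx hy se = aux (kind D x) refl
    where
    aux : ∀ kk → kind D x ≡ kk → x ≡ y
    aux top k = top-unique {D = D} wf x y rx ry k (proj₁ (st x y rx ry hx hy se) k)
    aux bot k = bot-unique {D = D} wf x y rx ry k (proj₁ (proj₂ (st x y rx ry hx hy se)) k)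
    aux (inner ℓ a b) k with proj₂ (proj₂ (st x y rx ry hx hy se)) ℓ a b k
    ... | c , d , k' , sa , sb = go m st hx hy
      where
      go : ∀ m → ShapeWithin m → n ≤ m + rk D x → n ≤ m + rk D y → x ≡ y
      go zero st hx hy = ⊥-elim (no-inner-without-budget hx k)
      go (suc m) st hx hy =
        nsf x y ℓ a b rx ry k (trans k' (cong₂ (inner ℓ) (sym ac) (sym bd)))
        where
        ra = reach-0 rx k
        rb = reach-1 rx k
        rc = reach-0 ry k'
        rd = reach-1 ry k'
        o = ordered {D = D} wf
        st' : ShapeWithin m
        st' x y rx ry hx hy = st x y rx ry (NP.≤-trans hx (NP.n≤1+n _)) (NP.≤-trans hy (NP.n≤1+n _))
        hx' : n ≤ suc m + toℕ ℓ
        hx' = subst (λ z → n ≤ suc m + z) (rank-inner k) hx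
        hy' : n ≤ suc m + toℕ ℓ
        hy' = subst (λ z → n ≤ suc m + z) (rank-inner k') hy
        ac : a ≡ c
        ac = equivalent⇒equal m st' a c ra rc
               (budget-step hx' (proj₁ (o _ _ _ _ rx k))) (budget-step hy' (proj₁ (o _ _ _ _ ry k'))) sa
        bd : b ≡ d
        bd = equivalent⇒equal m st' b d rb rd
               (budget-step hx' (proj₂ (o _ _ _ _ rx k))) (budget-step hy' (proj₂ (o _ _ _ _ ry k'))) sb

-- BDD semantics

module _ {n : ℕ} where

  data BAcc (D : Diagram n) (X : Subset n) : Node D → Set where
    aend : ∀ {x} → kind D x ≡ top → BAcc D X x
    a0 : ∀ {x ℓ a b} → kind D x ≡ inner ℓ a b → lookup X ℓ ≡ false → BAcc D X a → BAcc D X x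
    a1 : ∀ {x ℓ a b} → kind D x ≡ inner ℓ a b → lookup X ℓ ≡ true → BAcc D X b → BAcc D X x

  bpath→acc : ∀ {D X x Y Z} → BPath D x Y Z → Y ⊆ X → (∀ e → e ∈ Z → e ∉ X) → BAcc D X x
  bpath→acc (end k) sub dis = aend k
  bpath→acc (arc0 {ℓ = ℓ} k p) sub dis =
    a0 k (∉⇒lookup (dis ℓ (SP.x∈p∪q⁺ (inj₁ (SP.x∈⁅x⁆ ℓ)))))
         (bpath→acc p sub (λ e m → dis e (SP.x∈p∪q⁺ (inj₂ m))))
  bpath→acc (arc1 {ℓ = ℓ} k p) sub dis =
    a1 k (∈⇒lookup (sub (SP.x∈p∪q⁺ (inj₁ (SP.x∈⁅x⁆ ℓ)))))
         (bpath→acc p (λ m → sub (SP.x∈p∪q⁺ (inj₂ m))) dis)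

  acc→bpath : ∀ {D X x} → BAcc D X x → Σ (Subset n) λ Y → Σ (Subset n) λ Z →
              BPath D x Y Z × Y ⊆ X × (∀ e → e ∈ Z → e ∉ X)
  acc→bpath (aend k) = ∅ , ∅ , end k , (λ m → ⊥-elim (SP.∉⊥ m)) , (λ e m → ⊥-elim (SP.∉⊥ m))
  acc→bpath {X = X} (a0 {ℓ = ℓ} k l acc) with acc→bpath acc
  ... | Y , Z , p , sub , dis = Y , ⁅ ℓ ⁆ ∪ Z , arc0 k p , sub , dis'
    where
    dis' : ∀ e → e ∈ ⁅ ℓ ⁆ ∪ Z → e ∉ X
    dis' e m with SP.x∈p∪q⁻ ⁅ ℓ ⁆ Z m
    ... | inj₁ m' = subst (_∉ X) (sym (SP.x∈⁅y⁆⇒x≡y ℓ m')) (lookup⇒∉ l)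
    ... | inj₂ m' = dis e m'
  acc→bpath {X = X} (a1 {ℓ = ℓ} k l acc) with acc→bpath acc
  ... | Y , Z , p , sub , dis = ⁅ ℓ ⁆ ∪ Y , Z , arc1 k p , sub' , dis
    where
    sub' : ⁅ ℓ ⁆ ∪ Y ⊆ X
    sub' {e} m with SP.x∈p∪q⁻ ⁅ ℓ ⁆ Y m
    ... | inj₁ m' = subst (_∈ X) (sym (SP.x∈⁅y⁆⇒x≡y ℓ m')) (lookup⇒∈ l)
    ... | inj₂ m' = sub m'

  bsem→acc : ∀ {D X} → BSem D X → BAcc D X (root D)
  bsem→acc (Y , Z , p , sub , dis) = bpath→acc p sub dis

  acc→bsem : ∀ {D X} → BAcc D X (root D) → BSem D X
  acc→bsem = acc→bpath

  acc-bot : ∀ {D X x} → kind D x ≡ bot → BAcc D X x → Empty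
  acc-bot k (aend k') = bot≢top k k'
  acc-bot k (a0 k' _ _) = bot≢inner k k'
  acc-bot k (a1 k' _ _) = bot≢inner k k'

  acc-inv0 : ∀ {D X x ℓ a b} → kind D x ≡ inner ℓ a b → BAcc D X x → lookup X ℓ ≡ false →
    BAcc D X a
  acc-inv0 k (aend k') l = ⊥-elim (top≢inner k' k)
  acc-inv0 k (a0 k' l' acc) l with inner-unique k' k
  ... | refl , refl , refl = acc
  acc-inv0 k (a1 k' l' acc) l with inner-unique k' k
  ... | refl , refl , refl = ⊥-elim (bool-clash l' l)

  acc-inv1 : ∀ {D X x ℓ a b} → kind D x ≡ inner ℓ a b → BAcc D X x → lookup X ℓ ≡ true →
    BAcc D X b
  acc-inv1 k (aend k') l = ⊥-elim (top≢inner k' k)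
  acc-inv1 k (a0 k' l' acc) l with inner-unique k' k
  ... | refl , refl , refl = ⊥-elim (bool-clash l l')
  acc-inv1 k (a1 k' l' acc) l with inner-unique k' k
  ... | refl , refl , refl = acc

  acc-local : ∀ {D X X' u} → Ordered D → Reach D u → AgreeFrom (rk D u) X X' → BAcc D X u → BAcc D X' u
  acc-local o r ag (aend k) = aend k
  acc-local {D} {X} {X'} {u} o r ag (a0 {ℓ = ℓ} {a} k l acc) =
    a0 k (trans (sym (ag ℓ (NP.≤-reflexive (rank-inner k)))) l)
         (acc-local o (reach-0 r k) (λ e le → ag e (NP.≤-trans (inner-rank≤ k (proj₁ (o _ _ _ _ r k))) le)) acc)
  acc-local {D} {X} {X'} {u} o r ag (a1 {ℓ = ℓ} {b = b} k l acc) =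
    a1 k (trans (sym (ag ℓ (NP.≤-reflexive (rank-inner k)))) l)
         (acc-local o (reach-1 r k) (λ e le → ag e (NP.≤-trans (inner-rank≤ k (proj₂ (o _ _ _ _ r k))) le)) acc)

  mutual
    evB : (D : Diagram n) → ℕ → Node D → Subset n → Bool
    evB D zero u X = false
    evB D (suc f) u X = evK D f (kind D u) X

    evK : (D : Diagram n) → ℕ → Kind (Node D) n → Subset n → Bool
    evK D f bot X = false
    evK D f top X = true
    evK D f (inner ℓ a b) X = if lookup X ℓ then evB D f b X else evB D f a X

  evB-correct : ∀ {D} → Ordered D → ∀ m {u} X → Reach D u → n ≤ m + rk D u →
           (evB D (suc m) u X ≡ true → BAcc D X u) × (BAcc D X u → evB D (suc m) u X ≡ true)
  evB-correct {D} o m {u} X r h = aux m (kind D u) refl h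
    where
    aux : ∀ m kk → kind D u ≡ kk → n ≤ m + rk D u →
      (evK D m kk X ≡ true → BAcc D X u) × (BAcc D X u → evK D m kk X ≡ true)
    aux m bot k h = (λ ()) , (λ acc → ⊥-elim (acc-bot k acc))
    aux m top k h = (λ _ → aend k) , (λ _ → refl)
    aux zero (inner ℓ a b) k h = ⊥-elim (no-inner-without-budget h k)
    aux (suc m) (inner ℓ a b) k h with lookup X ℓ in l
    ... | true = (λ e → a1 k l (proj₁ ih e)) , (λ acc → proj₂ ih (acc-inv1 k acc l))
      where ih = evB-correct o m X (reach-1 r k)
                   (budget-step (subst (λ z → n ≤ suc m + z) (rank-inner k) h) (proj₂ (o _ _ _ _ r k)))
    ... | false = (λ e → a0 k l (proj₁ ih e)) , (λ acc → proj₂ ih (acc-inv0 k acc l))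
      where ih = evB-correct o m X (reach-0 r k)
                   (budget-step (subst (λ z → n ≤ suc m + z) (rank-inner k) h) (proj₁ (o _ _ _ _ r k)))

module _ {n : ℕ} where

  AccS : (E : Diagram n) → Node E → Subset n → Set
  AccS E u X = BAcc E X u

  evS : (E : Diagram n) → Node E → Subset n → Bool
  evS E u X = evB E (suc n) u X

  BEquiv : (E1 : Diagram n) → Node E1 → (E2 : Diagram n) → Node E2 → Set
  BEquiv E1 x E2 y = ∀ X → (BAcc E1 X x → BAcc E2 X y) × (BAcc E2 X y → BAcc E1 X x)

  BSameShape : (D1 D2 : Diagram n) → Node D1 → Node D2 → Set
  BSameShape D1 D2 = Canonical.SameShape AccS evS D1 D2

  BReduced : Diagram n → Set
  BReduced D = WellFormed D × NSFree D × BNDFree D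

  LabelIrrelevant : (D : Diagram n) → Node D → Fin n → Set
  LabelIrrelevant D z ℓ = (∀ X → BAcc D (X [ ℓ ]≔ false) z → BAcc D (X [ ℓ ]≔ true) z) ×
                          (∀ X → BAcc D (X [ ℓ ]≔ true) z → BAcc D (X [ ℓ ]≔ false) z)

  acc-≔-below-rank : ∀ {D : Diagram n} {X u e} → Ordered D → Reach D u → toℕ e < rk D u → ∀ v →
    (BAcc D X u → BAcc D (X [ e ]≔ v) u) × (BAcc D (X [ e ]≔ v) u → BAcc D X u)
  acc-≔-below-rank {D} {X} {u} {e} o r lt v = acc-local o r agree , acc-local o r (λ e' le → sym (agree e' le))
    where
    agree : AgreeFrom (rk D u) X (X [ e ]≔ v)
    agree e' le = sym (lookup-≔-other X v (λ eq → NP.<⇒≱ lt (subst (λ z → rk D u ≤ toℕ z) eq le)))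

  acc-child₀ : ∀ {D : Diagram n} {X x ℓ a b} → Ordered D → Reach D x → kind D x ≡ inner ℓ a b →
    (BAcc D X a → BAcc D (X [ ℓ ]≔ false) x) × (BAcc D (X [ ℓ ]≔ false) x → BAcc D X a)
  acc-child₀ {X = X} {ℓ = ℓ} o r k =
    (λ acc → a0 k (lookup-≔ X ℓ false) (proj₁ below acc)) ,
    (λ acc → proj₂ below (acc-inv0 k acc (lookup-≔ X ℓ false)))
    where below = acc-≔-below-rank o (reach-0 r k) (proj₁ (o _ _ _ _ r k)) false

  acc-child₁ : ∀ {D : Diagram n} {X x ℓ a b} → Ordered D → Reach D x → kind D x ≡ inner ℓ a b →
    (BAcc D X b → BAcc D (X [ ℓ ]≔ true) x) × (BAcc D (X [ ℓ ]≔ true) x → BAcc D X b)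
  acc-child₁ {X = X} {ℓ = ℓ} o r k =
    (λ acc → a1 k (lookup-≔ X ℓ true) (proj₁ below acc)) ,
    (λ acc → proj₂ below (acc-inv1 k acc (lookup-≔ X ℓ true)))
    where below = acc-≔-below-rank o (reach-1 r k) (proj₂ (o _ _ _ _ r k)) true

  label-irrelevant⇒children-equivalent : ∀ {D : Diagram n} {y ℓ c d} → Ordered D → Reach D y →
    kind D y ≡ inner ℓ c d → LabelIrrelevant D y ℓ → BEquiv D c D d
  label-irrelevant⇒children-equivalent o r k (irr₀₁ , irr₁₀) X =
    (λ acc → proj₂ (acc-child₁ o r k) (irr₀₁ X (proj₁ (acc-child₀ o r k) acc))) ,
    (λ acc → proj₂ (acc-child₀ o r k) (irr₁₀ X (proj₁ (acc-child₁ o r k) acc)))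

  equivalent⇒label-irrelevant : ∀ {D1 D2 : Diagram n} {x y ℓ} → Ordered D1 → Reach D1 x →
    BEquiv D1 x D2 y → toℕ ℓ < rk D1 x → LabelIrrelevant D2 y ℓ
  equivalent⇒label-irrelevant {ℓ = ℓ} o r se lt =
    (λ X acc → proj₁ (se _) (proj₁ (below X true) (proj₂ (below X false) (proj₂ (se _) acc)))) ,
    (λ X acc → proj₁ (se _) (proj₁ (below X false) (proj₂ (below X true) (proj₂ (se _) acc))))
    where below = λ X → acc-≔-below-rank {X = X} {e = ℓ} o r lt

  children-equivalent : ∀ {D1 D2 : Diagram n} {x y ℓ a b c d} → Ordered D1 → Ordered D2 →
    Reach D1 x → Reach D2 y → BEquiv D1 x D2 y →
    kind D1 x ≡ inner ℓ a b → kind D2 y ≡ inner ℓ c d → BEquiv D1 a D2 c × BEquiv D1 b D2 d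
  children-equivalent o1 o2 rx ry se kx ky =
    (λ X → (λ acc → proj₂ (acc-child₀ o2 ry ky) (proj₁ (se _) (proj₁ (acc-child₀ o1 rx kx) acc))) ,
           (λ acc → proj₂ (acc-child₀ o1 rx kx) (proj₂ (se _) (proj₁ (acc-child₀ o2 ry ky) acc)))) ,
    (λ X → (λ acc → proj₂ (acc-child₁ o2 ry ky) (proj₁ (se _) (proj₁ (acc-child₁ o1 rx kx) acc))) ,
           (λ acc → proj₂ (acc-child₁ o1 rx kx) (proj₂ (se _) (proj₁ (acc-child₁ o2 ry ky) acc))))

  below-terminal : ∀ {D : Diagram n} {x} (ℓ : Fin n) → kind D x ≡ top ⊎ kind D x ≡ bot →
    toℕ ℓ < rk D x
  below-terminal ℓ (inj₁ k) = subst (toℕ ℓ <_) (sym (cong rank k)) (FP.toℕ<n ℓ)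
  below-terminal ℓ (inj₂ k) = subst (toℕ ℓ <_) (sym (cong rank k)) (FP.toℕ<n ℓ)

  top-bot-inequivalent : ∀ {D1 D2 : Diagram n} {x y} → kind D1 x ≡ top → kind D2 y ≡ bot →
    BEquiv D1 x D2 y → Empty
  top-bot-inequivalent kx ky se = acc-bot ky (proj₁ (se ∅) (aend kx))

  ShapeUpTo : ℕ → Set₁
  ShapeUpTo m = ∀ (D1 D2 : Diagram n) → BReduced D1 → BReduced D2 → ∀ x y → Reach D1 x → Reach D2 y →
    n ≤ m + rk D1 x → n ≤ m + rk D2 y → BEquiv D1 x D2 y → BSameShape D1 D2 x y

  -- Equivalent nodes are compared by their labels: an element below the rank of one node is
  -- irrelevant for both, and in a reduced BDD the label of an inner node is relevant, because
  -- otherwise its children would be equivalent, hence equal (by induction), violating (B-ND).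
  same-shape : ∀ m → ShapeUpTo m
  same-shape m D1 D2 R1 R2 x y rx ry hx hy se = ftop , fbot , finner
    where
    o1 = ordered {D = D1} (proj₁ R1)
    o2 = ordered {D = D2} (proj₁ R2)

    label-relevant : ∀ m (D : Diagram n) → BReduced D → ∀ z ℓ c d → Reach D z → n ≤ m + rk D z →
      kind D z ≡ inner ℓ c d → LabelIrrelevant D z ℓ → Empty
    label-relevant zero D R z ℓ c d r h k irr = no-inner-without-budget h k
    label-relevant (suc m) D R z ℓ c d r h k irr =
      proj₂ (proj₂ R) z ℓ c d r k
        (UniqueUpToEquivalence.equivalent⇒equal AccS D (proj₁ R) (proj₁ (proj₂ R)) m (same-shape m D D R R)
           c d (reach-0 r k) (reach-1 r k)
           (budget-step h' (proj₁ (o _ _ _ _ r k))) (budget-step h' (proj₂ (o _ _ _ _ r k)))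
           (label-irrelevant⇒children-equivalent o r k irr))
      where
      o = ordered {D = D} (proj₁ R)
      h' = subst (λ w → n ≤ suc m + w) (rank-inner k) h

    se' : BEquiv D2 y D1 x
    se' X = proj₂ (se X) , proj₁ (se X)

    y-terminal : (kind D1 x ≡ top ⊎ kind D1 x ≡ bot) → ∀ ℓ c d → kind D2 y ≡ inner ℓ c d → Empty
    y-terminal t ℓ c d ky =
      label-relevant m D2 R2 y ℓ c d ry hy ky
        (equivalent⇒label-irrelevant o1 rx se (below-terminal {D = D1} ℓ t))

    x-terminal : (kind D2 y ≡ top ⊎ kind D2 y ≡ bot) → ∀ ℓ a b → kind D1 x ≡ inner ℓ a b → Empty
    x-terminal t ℓ a b kx =
      label-relevant m D1 R1 x ℓ a b rx hx kx
        (equivalent⇒label-irrelevant o2 ry se' (below-terminal {D = D2} ℓ t))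

    ftop : kind D1 x ≡ top → kind D2 y ≡ top
    ftop kx = aux (kind D2 y) refl
      where
      aux : ∀ kk → kind D2 y ≡ kk → kind D2 y ≡ top
      aux top ky = ky
      aux bot ky = ⊥-elim (top-bot-inequivalent kx ky se)
      aux (inner ℓ c d) ky = ⊥-elim (y-terminal (inj₁ kx) ℓ c d ky)

    fbot : kind D1 x ≡ bot → kind D2 y ≡ bot
    fbot kx = aux (kind D2 y) refl
      where
      aux : ∀ kk → kind D2 y ≡ kk → kind D2 y ≡ bot
      aux bot ky = ky
      aux top ky = ⊥-elim (top-bot-inequivalent ky kx se')
      aux (inner ℓ c d) ky = ⊥-elim (y-terminal (inj₂ kx) ℓ c d ky)

    finner : ∀ ℓ a b → kind D1 x ≡ inner ℓ a b → Σ (Node D2) λ c → Σ (Node D2) λ d →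
      kind D2 y ≡ inner ℓ c d × BEquiv D1 a D2 c × BEquiv D1 b D2 d
    finner ℓ a b kx = aux (kind D2 y) refl
      where
      aux : ∀ kk → kind D2 y ≡ kk → Σ (Node D2) λ c → Σ (Node D2) λ d →
            kind D2 y ≡ inner ℓ c d × BEquiv D1 a D2 c × BEquiv D1 b D2 d
      aux top ky = ⊥-elim (x-terminal (inj₁ ky) ℓ a b kx)
      aux bot ky = ⊥-elim (x-terminal (inj₂ ky) ℓ a b kx)
      aux (inner ℓ' c d) ky with NP.<-cmp (toℕ ℓ) (toℕ ℓ')
      ... | tri< lt _ _ = ⊥-elim (label-relevant m D1 R1 x ℓ a b rx hx kx
              (equivalent⇒label-irrelevant o2 ry se' (subst (toℕ ℓ <_) (sym (rank-inner ky)) lt)))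
      ... | tri> _ _ gt = ⊥-elim (label-relevant m D2 R2 y ℓ' c d ry hy ky
              (equivalent⇒label-irrelevant o1 rx se (subst (toℕ ℓ' <_) (sym (rank-inner kx)) gt)))
      ... | tri≈ _ eq _ with FP.toℕ-injective eq
      ...   | refl = c , d , ky , children-equivalent o1 o2 rx ry se kx ky

  BDD-canonical : ∀ (D1 D2 : Diagram n) → BReduced D1 → BReduced D2 →
    BEquiv D1 (root D1) D2 (root D2) → D1 ≅ D2
  BDD-canonical D1 D2 R1 R2 se =
    Canonical.Construction.iso AccS evS D1 D2
      (λ X r → evB-correct o1 n X r (NP.m≤m+n n _))
      (λ X r → evB-correct o2 n X r (NP.m≤m+n n _))
      o2
      (λ x y rx ry → same-shape n D1 D2 R1 R2 x y rx ry (NP.m≤m+n n _) (NP.m≤m+n n _))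
      (unique D1 R1)
      (unique D2 R2)
      se
    where
    o1 = ordered {D = D1} (proj₁ R1)
    o2 = ordered {D = D2} (proj₁ R2)
    unique : ∀ D → BReduced D → ∀ x y → Reach D x → Reach D y → BEquiv D x D y → x ≡ y
    unique D R x y rx ry = UniqueUpToEquivalence.equivalent⇒equal AccS D (proj₁ R) (proj₁ (proj₂ R)) n
      (same-shape n D D R R) x y rx ry (NP.m≤m+n n _) (NP.m≤m+n n _)

-- Reduction steps preserve the semantics

module _ {n : ℕ} where

  mapKind-top⁻ : ∀ {N M : Set} {f : N → M} {k : Kind N n} → mapKind f k ≡ top → k ≡ top
  mapKind-top⁻ {k = top} e = refl
  mapKind-top⁻ {k = bot} ()
  mapKind-top⁻ {k = inner _ _ _} ()

  mapKind-bot⁻ : ∀ {N M : Set} {f : N → M} {k : Kind N n} → mapKind f k ≡ bot → k ≡ bot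
  mapKind-bot⁻ {k = bot} e = refl
  mapKind-bot⁻ {k = top} ()
  mapKind-bot⁻ {k = inner _ _ _} ()

  mapKind-inner⁻ : ∀ {N M : Set} {f : N → M} {k : Kind N n} {ℓ a' b'} → mapKind f k ≡ inner ℓ a' b' →
             Σ N λ a → Σ N λ b → k ≡ inner ℓ a b × f a ≡ a' × f b ≡ b'
  mapKind-inner⁻ {k = inner ℓ a b} refl = a , b , refl , refl , refl
  mapKind-inner⁻ {k = top} ()
  mapKind-inner⁻ {k = bot} ()

-- Redirecting v to t loses no accepted set as long as t accepts only sets that v accepts
-- (acc-redirect⁻); the converse direction depends on the rule.
module Redirection {n : ℕ} (D : Diagram n) (v t : Node D) where
  R : Diagram n
  R = redirect D v t

  r : Node D → Node D
  r y = if does (_≟N_ D y v) then t else y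

  r-cases : ∀ y → (y ≡ v × r y ≡ t) ⊎ (y ≢ v × r y ≡ y)
  r-cases y with _≟N_ D y v
  ... | yes e = inj₁ (e , refl)
  ... | no ne = inj₂ (ne , refl)

  reach-r : Reach D t → ∀ {y} → Reach D y → Reach D (r y)
  reach-r rt {y} ry with r-cases y
  ... | inj₁ (_ , e) = subst (Reach D) (sym e) rt
  ... | inj₂ (_ , e) = subst (Reach D) (sym e) ry

  reach-redirect⁻ : Reach D t → ∀ {x} → Reach R x → Reach D x
  reach-redirect⁻ rt reach-root = reach-r rt reach-root
  reach-redirect⁻ rt (reach-0 {x} r' k) with mapKind-inner⁻ {f = r} {k = kind D x} k
  ... | a , b , k' , ea , eb = subst (Reach D) ea (reach-r rt (reach-0 (reach-redirect⁻ rt r') k'))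
  reach-redirect⁻ rt (reach-1 {x} r' k) with mapKind-inner⁻ {f = r} {k = kind D x} k
  ... | a , b , k' , ea , eb = subst (Reach D) eb (reach-r rt (reach-1 (reach-redirect⁻ rt r') k'))

  rk-r : rk D v ≤ rk D t → ∀ y → rk D y ≤ rk D (r y)
  rk-r h y with r-cases y
  ... | inj₁ (refl , e) = subst (λ z → rk D v ≤ rk D z) (sym e) h
  ... | inj₂ (_ , e) = subst (λ z → rk D y ≤ rk D z) (sym e) NP.≤-refl

  redirect-wellFormed : WellFormed D → Reach D t → rk D v ≤ rk D t → WellFormed R
  redirect-wellFormed w rt h = o' , ub , ut
    where
    o = ordered {D = D} w
    o' : Ordered R
    o' x ℓ a' b' rx k with mapKind-inner⁻ {f = r} {k = kind D x} k
    ... | a , b , k' , refl , refl =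
      NP.<-≤-trans (proj₁ (o _ _ _ _ (reach-redirect⁻ rt rx) k'))
        (NP.≤-trans (rk-r h a) (NP.≤-reflexive (sym (rank-map r (kind D (r a)))))) ,
      NP.<-≤-trans (proj₂ (o _ _ _ _ (reach-redirect⁻ rt rx) k'))
        (NP.≤-trans (rk-r h b) (NP.≤-reflexive (sym (rank-map r (kind D (r b))))))
    ub : ∀ x y → Reach R x → Reach R y → kind R x ≡ bot → kind R y ≡ bot → x ≡ y
    ub x y rx ry kx ky = bot-unique {D = D} w x y (reach-redirect⁻ rt rx) (reach-redirect⁻ rt ry)
      (mapKind-bot⁻ {f = r} {k = kind D x} kx) (mapKind-bot⁻ {f = r} {k = kind D y} ky)
    ut : ∀ x y → Reach R x → Reach R y → kind R x ≡ top → kind R y ≡ top → x ≡ y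
    ut x y rx ry kx ky = top-unique {D = D} w x y (reach-redirect⁻ rt rx) (reach-redirect⁻ rt ry)
      (mapKind-top⁻ {f = r} {k = kind D x} kx) (mapKind-top⁻ {f = r} {k = kind D y} ky)

  acc-r⁻ : (∀ X → BAcc D X t → BAcc D X v) → ∀ {X y} → BAcc D X (r y) → BAcc D X y
  acc-r⁻ h {X} {y} acc with r-cases y
  ... | inj₁ (refl , e) = h X (subst (BAcc D X) e acc)
  ... | inj₂ (_ , e) = subst (BAcc D X) e acc

  acc-redirect⁻ : (∀ X → BAcc D X t → BAcc D X v) → ∀ {X x} → BAcc R X x → BAcc D X x
  acc-redirect⁻ h {X} {x} (aend k) = aend (mapKind-top⁻ {f = r} {k = kind D x} k)
  acc-redirect⁻ h {X} {x} (a0 k l acc) with mapKind-inner⁻ {f = r} {k = kind D x} k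
  ... | a , b , k' , refl , refl = a0 k' l (acc-r⁻ h (acc-redirect⁻ h acc))
  acc-redirect⁻ h {X} {x} (a1 k l acc) with mapKind-inner⁻ {f = r} {k = kind D x} k
  ... | a , b , k' , refl , refl = a1 k' l (acc-r⁻ h (acc-redirect⁻ h acc))

  acc-redirect-merged : kind D t ≡ kind D v → ∀ {X x} → BAcc D X x → BAcc R X (r x)
  acc-redirect-merged kt {X} {x} acc = go acc (kr x)
    where
    kr : ∀ y → kind D (r y) ≡ kind D y
    kr y with r-cases y
    ... | inj₁ (refl , e) = trans (cong (kind D) e) kt
    ... | inj₂ (_ , e) = cong (kind D) e
    go : ∀ {x} → BAcc D X x → kind D (r x) ≡ kind D x → BAcc R X (r x)
    go {x} (aend k) e = aend (cong (mapKind r) (trans e k))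
    go {x} (a0 {a = a} k l acc) e = a0 (cong (mapKind r) (trans e k)) l (go acc (kr a))
    go {x} (a1 {b = b} k l acc) e = a1 (cong (mapKind r) (trans e k)) l (go acc (kr b))

  acc-redirect-skipped : ∀ {ℓv} → Ordered D → Reach D v → kind D v ≡ inner ℓv t t →
    ∀ {X x} → BAcc D X x → BAcc R X (r x)
  acc-redirect-skipped {ℓv} o rv kv {X} = go
    where
    t≢v : t ≢ v
    t≢v e = NP.<-irrefl (sym (rank-inner kv)) (subst (λ z → toℕ ℓv < rk D z) e (proj₁ (o _ _ _ _ rv kv)))
    rt : r t ≡ t
    rt with r-cases t
    ... | inj₁ (e , _) = ⊥-elim (t≢v e)
    ... | inj₂ (_ , e) = e
    go : ∀ {x} → BAcc D X x → BAcc R X (r x)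
    go {x} acc with r-cases x
    go {x} (aend k) | inj₁ (refl , e) = ⊥-elim (top≢inner k kv)
    go {x} (a0 k l acc) | inj₁ (refl , e) with inner-unique k kv
    ... | _ , refl , refl = subst (BAcc R X) (trans rt (sym e)) (go acc)
    go {x} (a1 k l acc) | inj₁ (refl , e) with inner-unique k kv
    ... | _ , refl , refl = subst (BAcc R X) (trans rt (sym e)) (go acc)
    go {x} (aend k) | inj₂ (ne , e) = subst (BAcc R X) (sym e) (aend (cong (mapKind r) k))
    go {x} (a0 k l acc) | inj₂ (ne , e) = subst (BAcc R X) (sym e) (a0 (cong (mapKind r) k) l (go acc))
    go {x} (a1 k l acc) | inj₂ (ne , e) = subst (BAcc R X) (sym e) (a1 (cong (mapKind r) k) l (go acc))

module _ {n : ℕ} where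

  acc-same : ∀ {D : Diagram n} {X x y} → kind D x ≡ kind D y → BAcc D X x → BAcc D X y
  acc-same e (aend k) = aend (trans (sym e) k)
  acc-same e (a0 k l acc) = a0 (trans (sym e) k) l acc
  acc-same e (a1 k l acc) = a1 (trans (sym e) k) l acc

  BEquiv-refl : ∀ {D : Diagram n} {x} → BEquiv D x D x
  BEquiv-refl X = (λ a → a) , (λ a → a)

  BEquiv-trans : ∀ {D1 D2 D3 : Diagram n} {x y z} → BEquiv D1 x D2 y → BEquiv D2 y D3 z → BEquiv D1 x D3 z
  BEquiv-trans s t X = (λ p → proj₁ (t X) (proj₁ (s X) p)) , (λ p → proj₂ (s X) (proj₂ (t X) p))

  BStep-sound : ∀ {D D' : Diagram n} → BStep D D' → WellFormed D →
    WellFormed D' × BEquiv D (root D) D' (root D')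
  BStep-sound {D} (step-ns (ns u v ℓ a b ru rv ne ku kv)) w =
    redirect-wellFormed w ru (NP.≤-reflexive (cong rank (trans kv (sym ku)))) ,
    λ X → (λ acc → acc-redirect-merged (trans ku (sym kv)) acc) ,
          (λ acc → acc-r⁻ h (acc-redirect⁻ h acc))
    where
    open Redirection D v u
    h : ∀ X → BAcc D X u → BAcc D X v
    h X = acc-same (trans ku (sym kv))
  BStep-sound {D} (step-bnd (bnd ν ℓ a rν k)) w =
    redirect-wellFormed w (reach-0 rν k)
      (NP.<⇒≤ (subst (_< rk D a) (sym (rank-inner k)) (proj₁ (ordered {D = D} w _ _ _ _ rν k)))) ,
    λ X → (λ acc → acc-redirect-skipped (ordered {D = D} w) rν k acc) ,
          (λ acc → acc-r⁻ h (acc-redirect⁻ h acc))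
    where
    open Redirection D ν a
    h : ∀ X → BAcc D X a → BAcc D X ν
    h X acc with lookup X ℓ in l
    ... | true = a1 k l acc
    ... | false = a0 k l acc

  BSteps-sound : ∀ {D D' : Diagram n} → Star BStep D D' → WellFormed D →
    WellFormed D' × BEquiv D (root D) D' (root D')
  BSteps-sound ε w = w , BEquiv-refl
  BSteps-sound (s ◅ ss) w with BStep-sound s w
  ... | w' , se with BSteps-sound ss w'
  ...   | w'' , se' = w'' , BEquiv-trans se se'

-- The complete decision tree

module CompleteTree {n : ℕ} (S : Family n) where
  T : Diagram n
  T = completeTree S

  leaf : Subset n → TNode n
  leaf P = if does (mem? S P) then ttop else tbot

  nodeAt-yes : ∀ {j P} → j < n → nodeAt S j P ≡ tin j P
  nodeAt-yes {j} {P} lt with j <? n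
  ... | yes _ = refl
  ... | no ¬lt = ⊥-elim (¬lt lt)

  nodeAt-no : ∀ {j P} → ¬ (j < n) → nodeAt S j P ≡ leaf P
  nodeAt-no {j} {P} ¬lt with j <? n
  ... | yes lt = ⊥-elim (¬lt lt)
  ... | no _ = refl

  treeKind-yes : ∀ {j P} (lt : j < n) → treeKind S (tin j P) ≡
    inner (fromℕ< lt) (nodeAt S (suc j) (P [ fromℕ< lt ]≔ false))
                      (nodeAt S (suc j) (P [ fromℕ< lt ]≔ true))
  treeKind-yes {j} {P} lt with j <? n
  ... | yes _ = refl
  ... | no ¬lt = ⊥-elim (¬lt lt)

  leaf-cases : ∀ P → (Mem S P × leaf P ≡ ttop) ⊎ (¬ Mem S P × leaf P ≡ tbot)
  leaf-cases P with mem? S P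
  ... | yes m = inj₁ (m , refl)
  ... | no m = inj₂ (m , refl)

  TreeNode : TNode n → Set
  TreeNode x = x ≡ tbot ⊎ x ≡ ttop ⊎ Σ ℕ λ j → Σ (Subset n) λ P → j < n × x ≡ tin j P

  leaf-treeNode : ∀ P → TreeNode (leaf P)
  leaf-treeNode P with leaf-cases P
  ... | inj₁ (_ , e) = inj₂ (inj₁ e)
  ... | inj₂ (_ , e) = inj₁ e

  nodeAt-treeNode : ∀ j P → TreeNode (nodeAt S j P)
  nodeAt-treeNode j P with j <? n
  ... | yes lt = inj₂ (inj₂ (j , P , lt , refl))
  ... | no ¬lt = leaf-treeNode P

  children-treeNode : ∀ {x ℓ a b} → TreeNode x → kind T x ≡ inner ℓ a b → TreeNode a × TreeNode b
  children-treeNode (inj₁ refl) ()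
  children-treeNode (inj₂ (inj₁ refl)) ()
  children-treeNode (inj₂ (inj₂ (j , P , lt , refl))) k with inner-unique (treeKind-yes {j} {P} lt) k
  ... | refl , refl , refl = nodeAt-treeNode _ _ , nodeAt-treeNode _ _

  reach⇒treeNode : ∀ {x} → Reach T x → TreeNode x
  reach⇒treeNode reach-root = nodeAt-treeNode 0 ∅
  reach⇒treeNode (reach-0 r k) = proj₁ (children-treeNode (reach⇒treeNode r) k)
  reach⇒treeNode (reach-1 r k) = proj₂ (children-treeNode (reach⇒treeNode r) k)

  rank-nodeAt : ∀ j P → j ≤ n → j ≤ rank (kind T (nodeAt S j P))
  rank-nodeAt j P le = go (j <? n)
    where
    go : Dec (j < n) → j ≤ rank (kind T (nodeAt S j P))
    go (yes lt) rewrite nodeAt-yes {j} {P} lt | treeKind-yes {j} {P} lt =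
      NP.≤-reflexive (sym (FP.toℕ-fromℕ< lt))
    go (no ¬lt) rewrite nodeAt-no {j} {P} ¬lt with leaf-cases P
    ... | inj₁ (_ , e) rewrite e = le
    ... | inj₂ (_ , e) rewrite e = le

  tree-wellFormed : WellFormed T
  tree-wellFormed = o , ub , ut
    where
    o : Ordered T
    o x ℓ a b r k with reach⇒treeNode r
    o x ℓ a b r () | inj₁ refl
    o x ℓ a b r () | inj₂ (inj₁ refl)
    ... | inj₂ (inj₂ (j , P , lt , refl)) with inner-unique (treeKind-yes {j} {P} lt) k
    ...   | refl , refl , refl =
      subst (_< rank (kind T (nodeAt S (suc j) (P [ fromℕ< lt ]≔ false)))) (sym (FP.toℕ-fromℕ< lt))
            (rank-nodeAt (suc j) _ lt) ,
      subst (_< rank (kind T (nodeAt S (suc j) (P [ fromℕ< lt ]≔ true)))) (sym (FP.toℕ-fromℕ< lt))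
            (rank-nodeAt (suc j) _ lt)
    treeNode-bot : ∀ {x} → TreeNode x → kind T x ≡ bot → x ≡ tbot
    treeNode-bot (inj₁ e) k = e
    treeNode-bot (inj₂ (inj₁ refl)) ()
    treeNode-bot (inj₂ (inj₂ (j , P , lt , refl))) k = ⊥-elim (bot≢inner k (treeKind-yes {j} {P} lt))
    treeNode-top : ∀ {x} → TreeNode x → kind T x ≡ top → x ≡ ttop
    treeNode-top (inj₁ refl) ()
    treeNode-top (inj₂ (inj₁ e)) k = e
    treeNode-top (inj₂ (inj₂ (j , P , lt , refl))) k = ⊥-elim (top≢inner k (treeKind-yes {j} {P} lt))
    ub : ∀ x y → Reach T x → Reach T y → kind T x ≡ bot → kind T y ≡ bot → x ≡ y
    ub x y rx ry kx ky = trans (treeNode-bot (reach⇒treeNode rx) kx) (sym (treeNode-bot (reach⇒treeNode ry) ky))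
    ut : ∀ x y → Reach T x → Reach T y → kind T x ≡ top → kind T y ≡ top → x ≡ y
    ut x y rx ry kx ky = trans (treeNode-top (reach⇒treeNode rx) kx) (sym (treeNode-top (reach⇒treeNode ry) ky))

  exhausted : ∀ {m j} → m + j ≡ n → ¬ (j < n) → j ≡ n
  exhausted {m} {j} e ¬lt = NP.≤-antisym (NP.≤-trans (NP.m≤n+m j m) (NP.≤-reflexive e)) (NP.≮⇒≥ ¬lt)

  splice-exhausted : ∀ {m j} (P X : Subset n) → m + j ≡ n → ¬ (j < n) → splice j P X ≡ P
  splice-exhausted P X e ¬lt = trans (cong (λ z → splice z P X) (exhausted e ¬lt)) (splice-all P X)

  tree-BAcc : ∀ m j P X → m + j ≡ n →
    (BAcc T X (nodeAt S j P) → Mem S (splice j P X)) ×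
    (Mem S (splice j P X) → BAcc T X (nodeAt S j P))
  tree-BAcc m j P X e = go m e (j <? n)
    where
    go : ∀ m → m + j ≡ n → Dec (j < n) →
      (BAcc T X (nodeAt S j P) → Mem S (splice j P X)) × (Mem S (splice j P X) → BAcc T X (nodeAt S j P))
    go zero refl (yes lt) = ⊥-elim (NP.<-irrefl refl lt)
    go (suc m) e (yes lt) rewrite nodeAt-yes {j} {P} lt with lookup X (fromℕ< lt) in l
    ... | true =
      (λ acc → subst (Mem S) eqv (proj₁ ih (acc-inv1 (treeKind-yes {j} {P} lt) acc l))) ,
      (λ mm → a1 (treeKind-yes {j} {P} lt) l (proj₂ ih (subst (Mem S) (sym eqv) mm)))
      where ih = tree-BAcc m (suc j) (P [ fromℕ< lt ]≔ true) X (trans (NP.+-suc m j) e)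
            eqv = trans (cong (λ z → splice (suc j) (P [ fromℕ< lt ]≔ z) X) (sym l)) (splice-step j P X lt)
    ... | false =
      (λ acc → subst (Mem S) eqv (proj₁ ih (acc-inv0 (treeKind-yes {j} {P} lt) acc l))) ,
      (λ mm → a0 (treeKind-yes {j} {P} lt) l (proj₂ ih (subst (Mem S) (sym eqv) mm)))
      where ih = tree-BAcc m (suc j) (P [ fromℕ< lt ]≔ false) X (trans (NP.+-suc m j) e)
            eqv = trans (cong (λ z → splice (suc j) (P [ fromℕ< lt ]≔ z) X) (sym l)) (splice-step j P X lt)
    go m e (no ¬lt) rewrite nodeAt-no {j} {P} ¬lt with leaf-cases P
    ... | inj₁ (mm , eq) rewrite eq =
      (λ _ → subst (Mem S) (sym (splice-exhausted P X e ¬lt)) mm) ,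
      (λ _ → aend refl)
    ... | inj₂ (nm , eq) rewrite eq =
      (λ acc → ⊥-elim (acc-bot refl acc)) ,
      (λ mm → ⊥-elim (nm (subst (Mem S) (splice-exhausted P X e ¬lt) mm)))

  tree-BSem : ∀ X → (BAcc T X (root T) → Mem S X) × (Mem S X → BAcc T X (root T))
  tree-BSem X =
    (λ acc → subst (Mem S) (splice-none ∅ X) (proj₁ root-BAcc acc)) ,
    (λ m → proj₂ root-BAcc (subst (Mem S) (sym (splice-none ∅ X)) m))
    where root-BAcc = tree-BAcc n 0 ∅ X (NP.+-identityʳ n)

-- The update ν₀ ← ν₁

module Update {n : ℕ} (D : Diagram n) where
  U : Diagram n
  U = update D

  update-inner : ∀ {x ℓ a b} → kind D x ≡ inner ℓ a b →
    (kind D a ≡ bot × kind U x ≡ inner ℓ b b) ⊎ (kind D a ≢ bot × kind U x ≡ inner ℓ a b)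
  update-inner {x} {ℓ} {a} {b} k rewrite k with kind D a in ka
  ... | bot = inj₁ (refl , refl)
  ... | top = inj₂ ((λ ()) , refl)
  ... | inner _ _ _ = inj₂ ((λ ()) , refl)

  update-top⁻ : ∀ {x} → kind U x ≡ top → kind D x ≡ top
  update-top⁻ {x} e with kind-view D x
  ... | inj₁ k = k
  ... | inj₂ (inj₁ k) = ⊥-elim (bot≢top refl (trans (sym (cong (updateKind D) k)) e))
  ... | inj₂ (inj₂ (ℓ , a , b , k)) with update-inner k
  ...   | inj₁ (_ , e') = ⊥-elim (top≢inner e e')
  ...   | inj₂ (_ , e') = ⊥-elim (top≢inner e e')

  update-bot⁻ : ∀ {x} → kind U x ≡ bot → kind D x ≡ bot
  update-bot⁻ {x} e with kind-view D x
  ... | inj₂ (inj₁ k) = k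
  ... | inj₁ k = ⊥-elim (bot≢top refl (trans (sym e) (cong (updateKind D) k)))
  ... | inj₂ (inj₂ (ℓ , a , b , k)) with update-inner k
  ...   | inj₁ (_ , e') = ⊥-elim (bot≢inner e e')
  ...   | inj₂ (_ , e') = ⊥-elim (bot≢inner e e')

  update-top : ∀ {x} → kind D x ≡ top → kind U x ≡ top
  update-top {x} k rewrite k = refl

  update-inner⁻ : ∀ {x ℓ a' b'} → kind U x ≡ inner ℓ a' b' →
    Σ (Node D) λ a → kind D x ≡ inner ℓ a b' × ((kind D a ≡ bot × a' ≡ b') ⊎ (kind D a ≢ bot × a' ≡ a))
  update-inner⁻ {x} {ℓ} {a'} {b'} e with kind-view D x
  ... | inj₁ k = ⊥-elim (top≢inner (cong (updateKind D) k) e)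
  ... | inj₂ (inj₁ k) = ⊥-elim (bot≢inner (cong (updateKind D) k) e)
  ... | inj₂ (inj₂ (ℓ₁ , a , b , k)) with update-inner k
  ...   | inj₁ (ka , e') with inner-unique e' e
  ...     | refl , refl , refl = a , k , inj₁ (ka , refl)
  update-inner⁻ {x} {ℓ} {a'} {b'} e | inj₂ (inj₂ (ℓ₁ , a , b , k)) | inj₂ (ka , e') with inner-unique e' e
  ...     | refl , refl , refl = a , k , inj₂ (ka , refl)

  reach-update⁻ : ∀ {x} → Reach U x → Reach D x
  reach-update⁻ reach-root = reach-root
  reach-update⁻ (reach-0 r k) with update-inner⁻ k
  ... | a , k' , inj₁ (_ , refl) = reach-1 (reach-update⁻ r) k'
  ... | a , k' , inj₂ (_ , refl) = reach-0 (reach-update⁻ r) k'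
  reach-update⁻ (reach-1 r k) with update-inner⁻ k
  ... | a , k' , _ = reach-1 (reach-update⁻ r) k'

  rank-update : ∀ x → rk U x ≡ rk D x
  rank-update x with kind-view D x
  ... | inj₁ k = trans (cong rank (cong (updateKind D) k)) (sym (cong rank k))
  ... | inj₂ (inj₁ k) = trans (cong rank (cong (updateKind D) k)) (sym (cong rank k))
  ... | inj₂ (inj₂ (ℓ , a , b , k)) with update-inner k
  ...   | inj₁ (_ , e) = trans (cong rank e) (sym (cong rank k))
  ...   | inj₂ (_ , e) = trans (cong rank e) (sym (cong rank k))

  update-wellFormed : WellFormed D → WellFormed U
  update-wellFormed w = o' , ub , ut
    where
    o = ordered {D = D} w
    o' : Ordered U
    o' x ℓ a' b' r k with update-inner⁻ k
    ... | a , k' , inj₁ (_ , refl) =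
      subst (toℕ ℓ <_) (sym (rank-update b')) (proj₂ (o _ _ _ _ (reach-update⁻ r) k')) ,
      subst (toℕ ℓ <_) (sym (rank-update b')) (proj₂ (o _ _ _ _ (reach-update⁻ r) k'))
    ... | a , k' , inj₂ (_ , refl) =
      subst (toℕ ℓ <_) (sym (rank-update a)) (proj₁ (o _ _ _ _ (reach-update⁻ r) k')) ,
      subst (toℕ ℓ <_) (sym (rank-update b')) (proj₂ (o _ _ _ _ (reach-update⁻ r) k'))
    ub : ∀ x y → Reach U x → Reach U y → kind U x ≡ bot → kind U y ≡ bot → x ≡ y
    ub x y rx ry kx ky =
      bot-unique {D = D} w x y (reach-update⁻ rx) (reach-update⁻ ry) (update-bot⁻ kx) (update-bot⁻ ky)
    ut : ∀ x y → Reach U x → Reach U y → kind U x ≡ top → kind U y ≡ top → x ≡ y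
    ut x y rx ry kx ky =
      top-unique {D = D} w x y (reach-update⁻ rx) (reach-update⁻ ry) (update-top⁻ kx) (update-top⁻ ky)

module BNonEmpty {n : ℕ} (D : Diagram n) (R : BReduced D) where
  private
    o = ordered {D = D} (proj₁ R)

  -- (B-ND) and the uniqueness of ⊥ forbid an inner node with two ⊥-children.
  accepts-some : ∀ m u → Reach D u → n ≤ m + rk D u → kind D u ≢ bot → Σ (Subset n) λ C → BAcc D C u
  accepts-some m u r h nb with kind-view D u
  ... | inj₁ k = ∅ , aend k
  ... | inj₂ (inj₁ k) = ⊥-elim (nb k)
  accepts-some zero u r h nb | inj₂ (inj₂ (ℓ , a , b , k)) = ⊥-elim (no-inner-without-budget h k)
  accepts-some (suc m) u r h nb | inj₂ (inj₂ (ℓ , a , b , k)) = go (kind-view D a) (kind-view D b)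
    where
    h' = subst (λ w → n ≤ suc m + w) (rank-inner k) h
    ra = reach-0 r k
    rb = reach-1 r k
    via₀ : kind D a ≢ bot → Σ (Subset n) λ C → BAcc D C u
    via₀ nba with accepts-some m a ra (budget-step h' (proj₁ (o _ _ _ _ r k))) nba
    ... | C , acc = C [ ℓ ]≔ false , proj₁ (acc-child₀ o r k) acc
    via₁ : kind D b ≢ bot → Σ (Subset n) λ C → BAcc D C u
    via₁ nbb with accepts-some m b rb (budget-step h' (proj₂ (o _ _ _ _ r k))) nbb
    ... | C , acc = C [ ℓ ]≔ true , proj₁ (acc-child₁ o r k) acc
    go : _ → _ → Σ (Subset n) λ C → BAcc D C u
    go (inj₁ ka) _ = via₀ (λ e → bot≢top e ka)
    go (inj₂ (inj₂ (_ , _ , _ , ka))) _ = via₀ (λ e → bot≢inner e ka)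
    go (inj₂ (inj₁ ka)) (inj₁ kb) = via₁ (λ e → bot≢top e kb)
    go (inj₂ (inj₁ ka)) (inj₂ (inj₂ (_ , _ , _ , kb))) = via₁ (λ e → bot≢inner e kb)
    go (inj₂ (inj₁ ka)) (inj₂ (inj₁ kb)) =
      ⊥-elim (proj₂ (proj₂ R) u ℓ a b r k (bot-unique {D = D} (proj₁ R) a b ra rb ka kb))

module BUpdate {n : ℕ} (M : Matroid n) (D : Diagram n) (R : BReduced D)
  (sem : ∀ X → (BAcc D X (root D) → IsBasis M X) × (IsBasis M X → BAcc D X (root D))) where
  open Update D
  open MatroidProperties M
  open BNonEmpty D R
  o = ordered {D = D} (proj₁ R)

  below-child : ∀ {u ℓ a b c} {e : Fin n} → kind D u ≡ inner ℓ a b → toℕ e < rk D u →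
    toℕ ℓ < rk D c → toℕ e < rk D c
  below-child {e = e} k lt lta = NP.<-trans (subst (toℕ e <_) (rank-inner k) lt) lta

  -- A redirected 0-arc is replaced by the 1-arc it copies, adding ℓ to the accepted set.
  update-acc⇒superset-acc : ∀ {X u} → BAcc U X u → Reach D u →
    Σ (Subset n) λ X' → X ⊆ X' × AgreeBelow (rk D u) X X' × BAcc D X' u
  update-acc⇒superset-acc {X} (aend k) r = X , (λ z → z) , (λ _ _ → refl) , aend (update-top⁻ k)
  update-acc⇒superset-acc {X} {u} (a0 {ℓ = ℓ} k l acc) r with update-inner⁻ k
  ... | a , k' , inj₁ (ka , refl) with update-acc⇒superset-acc acc (reach-1 r k')
  ...   | X' , X⊆X' , agree , acc' =
    X' [ ℓ ]≔ true , ⊆-≔true X⊆X' , agree' , proj₁ (acc-child₁ o r k') acc'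
    where
    agree' : AgreeBelow (rk D u) X (X' [ ℓ ]≔ true)
    agree' e lt = trans (agree e (below-child k' lt (proj₂ (o _ _ _ _ r k'))))
                        (sym (lookup-≔-other X' true (toℕ≢⇒≢ (NP.<⇒≢ (subst (toℕ e <_) (rank-inner k') lt)))))
  update-acc⇒superset-acc {X} {u} (a0 {ℓ = ℓ} k l acc) r | a , k' , inj₂ (ka , refl)
    with update-acc⇒superset-acc acc (reach-0 r k')
  ... | X' , X⊆X' , agree , acc' =
    X' , X⊆X' , (λ e lt → agree e (below-child k' lt lta)) , a0 k' (trans (sym (agree ℓ lta)) l) acc'
    where lta = proj₁ (o _ _ _ _ r k')
  update-acc⇒superset-acc {X} {u} (a1 {ℓ = ℓ} k l acc) r with update-inner⁻ k
  ... | a , k' , _ with update-acc⇒superset-acc acc (reach-1 r k')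
  ...   | X' , X⊆X' , agree , acc' =
    X' , X⊆X' , (λ e lt → agree e (below-child k' lt ltb)) , a1 k' (trans (sym (agree ℓ ltb)) l) acc'
    where ltb = proj₂ (o _ _ _ _ r k')

  sound : ∀ {X} → BAcc U X (root D) → Indep M X
  sound {X} acc with update-acc⇒superset-acc acc reach-root
  ... | X' , X⊆X' , _ , acc' = hereditary M X' X X⊆X' (proj₁ (proj₁ (sem X') acc'))

  -- u is where the path selected by B arrives after deciding the elements below rk u.
  Prefix : Node D → Subset n → Set
  Prefix u B = ∀ B' → AgreeBelow (rk D u) B B' →
    (BAcc D B' (root D) → BAcc D B' u) × (BAcc D B' u → BAcc D B' (root D))

  prefix-≈ : ∀ {u B B2} → Prefix u B → AgreeBelow (rk D u) B B2 → Prefix u B2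
  prefix-≈ p ag B' ag' = p B' (λ e lt → trans (ag e lt) (ag' e lt))

  prefix-child₀ : ∀ {u B ℓ a b} → Prefix u B → Reach D u → kind D u ≡ inner ℓ a b →
    lookup B ℓ ≡ false → Prefix a B
  prefix-child₀ {u} {B} {ℓ} {a} p r k l B' ag =
    (λ acc → acc-inv0 k (proj₁ (p B' ag') acc) l') , (λ acc → proj₂ (p B' ag') (a0 k l' acc))
    where
    lta = proj₁ (o _ _ _ _ r k)
    ag' : AgreeBelow (rk D u) B B'
    ag' e lt = ag e (below-child k lt lta)
    l' : lookup B' ℓ ≡ false
    l' = trans (sym (ag ℓ lta)) l

  prefix-child₁ : ∀ {u B ℓ a b} → Prefix u B → Reach D u → kind D u ≡ inner ℓ a b →
    lookup B ℓ ≡ true → Prefix b B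
  prefix-child₁ {u} {B} {ℓ} {b = b} p r k l B' ag =
    (λ acc → acc-inv1 k (proj₁ (p B' ag') acc) l') , (λ acc → proj₂ (p B' ag') (a1 k l' acc))
    where
    ltb = proj₂ (o _ _ _ _ r k)
    ag' : AgreeBelow (rk D u) B B'
    ag' e lt = ag e (below-child k lt ltb)
    l' : lookup B' ℓ ≡ true
    l' = trans (sym (ag ℓ ltb)) l

  -- Complete a set accepted by the 0-child by the prefix of B, with ℓ left out.
  basis-through-child₀ : ∀ m {u B ℓ a b} → Prefix u B → Reach D u → n ≤ suc m + rk D u →
    kind D u ≡ inner ℓ a b → kind D a ≢ bot →
    Σ (Subset n) λ B' → IsBasis M B' × ℓ ∉ B' × (∀ e → toℕ e < toℕ ℓ → lookup B' e ≡ lookup B e)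
  basis-through-child₀ m {u} {B} {ℓ} {a} pref r h k ka
    with accepts-some m a (reach-0 r k) (budget-step (subst (λ w → n ≤ suc m + w) (rank-inner k) h) lta) ka
    where lta = proj₁ (o _ _ _ _ r k)
  ... | C , accC = B' , basis , lookup⇒∉ ℓ∉B' , agree
    where
    lta = proj₁ (o _ _ _ _ r k)
    B' = splice (suc (toℕ ℓ)) (B [ ℓ ]≔ false) C
    ℓ∉B' : lookup B' ℓ ≡ false
    ℓ∉B' = trans (splice-below (suc (toℕ ℓ)) _ C ℓ (NP.n<1+n _)) (lookup-≔ B ℓ false)
    agree : ∀ e → toℕ e < toℕ ℓ → lookup B' e ≡ lookup B e
    agree e lt = trans (splice-below (suc (toℕ ℓ)) _ C e (NP.m<n⇒m<1+n lt))
                       (lookup-≔-other B false (toℕ≢⇒≢ (NP.<⇒≢ lt)))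
    accB' : BAcc D B' u
    accB' = a0 k ℓ∉B' (acc-local o (reach-0 r k) (λ e le → sym (splice-from _ _ C e (NP.≤-trans lta le))) accC)
    basis : IsBasis M B'
    basis = proj₁ (sem B') (proj₂ (pref B' (λ e lt → sym (agree e (subst (toℕ e <_) (rank-inner k) lt)))) accB')

  down : ∀ m u X B → Reach D u → n ≤ m + rk D u → IsBasis M B → X ⊆ B → Prefix u B → BAcc U X u
  down m u X B r h bB X⊆B pref with kind-view D u
  ... | inj₁ k = aend (update-top k)
  ... | inj₂ (inj₁ k) = ⊥-elim (acc-bot k (proj₁ (pref B (λ _ _ → refl)) (proj₂ (sem B) bB)))
  down zero u X B r h bB X⊆B pref | inj₂ (inj₂ (ℓ , a , b , k)) = ⊥-elim (no-inner-without-budget h k)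
  down (suc m) u X B r h bB X⊆B pref | inj₂ (inj₂ (ℓ , a , b , k)) = go (lookup X ℓ) refl
    where
    h' = subst (λ w → n ≤ suc m + w) (rank-inner k) h
    ra = reach-0 r k
    rb = reach-1 r k
    ha = budget-step h' (proj₁ (o _ _ _ _ r k))
    hb = budget-step h' (proj₂ (o _ _ _ _ r k))
    ℓ∈B : lookup X ℓ ≡ true → lookup B ℓ ≡ true
    ℓ∈B lX = ∈⇒lookup (X⊆B (lookup⇒∈ lX))
    go : ∀ v → lookup X ℓ ≡ v → BAcc U X u
    go true lX with update-inner k
    ... | inj₁ (_ , kU) = a1 kU lX (down m b X B rb hb bB X⊆B (prefix-child₁ {B = B} pref r k (ℓ∈B lX)))
    ... | inj₂ (_ , kU) = a1 kU lX (down m b X B rb hb bB X⊆B (prefix-child₁ {B = B} pref r k (ℓ∈B lX)))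
    go false lX = go₀ (lookup B ℓ) refl (update-inner k)
      where
      go₀ : ∀ w → lookup B ℓ ≡ w → _ → BAcc U X u
      go₀ false lB (inj₁ (ka , _)) =
        ⊥-elim (acc-bot ka (acc-inv0 k (proj₁ (pref B (λ _ _ → refl)) (proj₂ (sem B) bB)) lB))
      go₀ false lB (inj₂ (_ , kU)) = a0 kU lX (down m a X B ra ha bB X⊆B (prefix-child₀ {B = B} pref r k lB))
      go₀ true lB (inj₁ (_ , kU)) = a0 kU lX (down m b X B rb hb bB X⊆B (prefix-child₁ {B = B} pref r k lB))
      go₀ true lB (inj₂ (ka , kU)) with basis-through-child₀ m {B = B} pref r h k ka
      ... | B' , bB' , ℓ∉B' , agree' with exchange-above bB bB' (lookup⇒∈ lB) ℓ∉B' agree'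
      ...   | B₂ , bB₂ , ℓ∉B₂ , B₋⊆B₂ , agree₂ =
        a0 kU lX (down m a X B₂ ra ha bB₂ (λ z → B₋⊆B₂ (⊆-≔false X⊆B lX z))
          (prefix-child₀ {B = B₂}
            (prefix-≈ {B = B} {B2 = B₂} pref (λ e lt → sym (agree₂ e (subst (toℕ e <_) (rank-inner k) lt))))
            r k ℓ∉B₂))

  complete : ∀ {X} → Indep M X → BAcc U X (root D)
  complete {X} iX with extend-to-basis iX
  ... | B , bB , X⊆B =
    down n (root D) X B reach-root (NP.m≤m+n n _) bB X⊆B (λ B' _ → (λ z → z) , (λ z → z))

BAccepts : ∀ {n} → Diagram n → (Subset n → Set) → Set
BAccepts D P = ∀ X → (BAcc D X (root D) → P X) × (P X → BAcc D X (root D))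

BDD-accepts : ∀ {n} {D : Diagram n} {S : Family n} → IsBDDOf D S → BReduced D × BAccepts D (Mem S)
BDD-accepts {S = S} (steps , nsf , bndf) with BSteps-sound steps (CompleteTree.tree-wellFormed S)
... | wf , equiv = (wf , nsf , bndf) ,
  λ X → (λ acc → proj₁ (CompleteTree.tree-BSem S X) (proj₂ (equiv X) acc)) ,
        (λ m → proj₁ (equiv X) (proj₂ (CompleteTree.tree-BSem S X) m))

BAccepts⇒BEquiv : ∀ {n} {D1 D2 : Diagram n} {P : Subset n → Set} → BAccepts D1 P → BAccepts D2 P →
  BEquiv D1 (root D1) D2 (root D2)
BAccepts⇒BEquiv sem1 sem2 X = (λ acc → proj₂ (sem2 X) (proj₁ (sem1 X) acc)) ,
                              (λ acc → proj₂ (sem1 X) (proj₁ (sem2 X) acc))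

BAccepts⇒BRepresents : ∀ {n} {D : Diagram n} {S : Family n} → BAccepts D (Mem S) → BRepresents D S
BAccepts⇒BRepresents sem X = (λ s → proj₁ (sem X) (bsem→acc s)) , (λ m → acc→bsem (proj₂ (sem X) m))

bdd-update-theorem : (n : ℕ) (M : Matroid n) (basis? : Decidable (IsBasis M)) →
  (D₀ : Diagram n) → IsBDDOf D₀ (bases M basis?) →
  (D : Diagram n) → Star BStep (update D₀) D → NSFree D → BNDFree D →
  BRepresents D (independentSets M) × ((D' : Diagram n) → IsBDDOf D' (independentSets M) → D ≅ D')
bdd-update-theorem n M basis? D₀ isBDD₀ D steps nsf bndf =
  BAccepts⇒BRepresents {S = independentSets M} semD , iso
  where
  R₀ = proj₁ (BDD-accepts isBDD₀)
  open BUpdate M D₀ R₀ (proj₂ (BDD-accepts isBDD₀))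
  reduce = BSteps-sound steps (Update.update-wellFormed D₀ (proj₁ R₀))
  semD : BAccepts D (Indep M)
  semD X = (λ acc → sound (proj₂ (proj₂ reduce X) acc)) , (λ i → proj₁ (proj₂ reduce X) (complete i))
  iso : (D' : Diagram n) → IsBDDOf D' (independentSets M) → D ≅ D'
  iso D' isBDD' = BDD-canonical D D' (proj₁ reduce , nsf , bndf) (proj₁ (BDD-accepts isBDD'))
                    (BAccepts⇒BEquiv semD (proj₂ (BDD-accepts isBDD')))

-- ZDD semantics

module _ {n : ℕ} where

  Gap : Subset n → ℕ → ℕ → Set
  Gap X lo hi = ∀ e → lo ≤ toℕ e → toℕ e < hi → lookup X e ≡ false

  -- ZDD acceptance of X from x, where the elements below lo have already been decided:
  -- every element from lo on that no arc tests must be absent from X.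
  data ZAcc (D : Diagram n) (X : Subset n) : ℕ → Node D → Set where
    zend : ∀ {lo x} → kind D x ≡ top → (∀ e → lo ≤ toℕ e → lookup X e ≡ false) → ZAcc D X lo x
    z0 : ∀ {lo x ℓ a b} → kind D x ≡ inner ℓ a b → lo ≤ toℕ ℓ → Gap X lo (toℕ ℓ) →
         lookup X ℓ ≡ false → ZAcc D X (suc (toℕ ℓ)) a → ZAcc D X lo x
    z1 : ∀ {lo x ℓ a b} → kind D x ≡ inner ℓ a b → lo ≤ toℕ ℓ → Gap X lo (toℕ ℓ) →
         lookup X ℓ ≡ true → ZAcc D X (suc (toℕ ℓ)) b → ZAcc D X lo x

  zacc-gap : ∀ {D : Diagram n} {X lo u} → ZAcc D X lo u → Gap X lo (rk D u)
  zacc-gap (zend k g) e le lt = g e le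
  zacc-gap {D} {u = u} (z0 k le' g l acc) e le lt = g e le (subst (toℕ e <_) (rank-inner k) lt)
  zacc-gap {D} {u = u} (z1 k le' g l acc) e le lt = g e le (subst (toℕ e <_) (rank-inner k) lt)

  zacc-raise : ∀ {D : Diagram n} {X lo lo' u} → ZAcc D X lo u → lo ≤ lo' → lo' ≤ rk D u → ZAcc D X lo' u
  zacc-raise (zend k g) le le' = zend k (λ e l → g e (NP.≤-trans le l))
  zacc-raise (z0 k le0 g l acc) le le' =
    z0 k (subst (_ ≤_) (rank-inner k) le') (λ e l1 l2 → g e (NP.≤-trans le l1) l2) l acc
  zacc-raise (z1 k le0 g l acc) le le' =
    z1 k (subst (_ ≤_) (rank-inner k) le') (λ e l1 l2 → g e (NP.≤-trans le l1) l2) l acc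

  zacc-lower : ∀ {D : Diagram n} {X lo lo' u} → ZAcc D X lo u → lo' ≤ lo → Gap X lo' lo → ZAcc D X lo' u
  zacc-lower {X = X} {lo = lo} {lo' = lo'} (zend k g) le gp = zend k (λ e l → aux e l)
    where aux : ∀ e → lo' ≤ toℕ e → lookup X e ≡ false
          aux e l with toℕ e <? lo
          ... | yes lt = gp e l lt
          ... | no nlt = g e (NP.≮⇒≥ nlt)
  zacc-lower {X = X} {lo = lo} {lo' = lo'} (z0 {ℓ = ℓ} k le0 g l acc) le gp = z0 k (NP.≤-trans le le0) aux l acc
    where aux : ∀ e → lo' ≤ toℕ e → toℕ e < toℕ ℓ → lookup X e ≡ false
          aux e l1 l2 with toℕ e <? lo
          ... | yes lt = gp e l1 lt
          ... | no nlt = g e (NP.≮⇒≥ nlt) l2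
  zacc-lower {X = X} {lo = lo} {lo' = lo'} (z1 {ℓ = ℓ} k le0 g l acc) le gp = z1 k (NP.≤-trans le le0) aux l acc
    where aux : ∀ e → lo' ≤ toℕ e → toℕ e < toℕ ℓ → lookup X e ≡ false
          aux e l1 l2 with toℕ e <? lo
          ... | yes lt = gp e l1 lt
          ... | no nlt = g e (NP.≮⇒≥ nlt) l2

  zacc-local : ∀ {D : Diagram n} {X X' lo u} → AgreeFrom lo X X' → ZAcc D X lo u → ZAcc D X' lo u
  zacc-local ag (zend k g) = zend k (λ e l → trans (sym (ag e l)) (g e l))
  zacc-local ag (z0 {ℓ = ℓ} k le g l acc) =
    z0 k le (λ e l1 l2 → trans (sym (ag e l1)) (g e l1 l2)) (trans (sym (ag ℓ le)) l)
       (zacc-local (λ e l' → ag e (NP.≤-trans (NP.≤-trans le (NP.n≤1+n _)) l')) acc)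
  zacc-local ag (z1 {ℓ = ℓ} k le g l acc) =
    z1 k le (λ e l1 l2 → trans (sym (ag e l1)) (g e l1 l2)) (trans (sym (ag ℓ le)) l)
       (zacc-local (λ e l' → ag e (NP.≤-trans (NP.≤-trans le (NP.n≤1+n _)) l')) acc)

  zacc-bot : ∀ {D : Diagram n} {X lo x} → kind D x ≡ bot → ZAcc D X lo x → Empty
  zacc-bot k (zend k' _) = bot≢top k k'
  zacc-bot k (z0 k' _ _ _ _) = bot≢inner k k'
  zacc-bot k (z1 k' _ _ _ _) = bot≢inner k k'

  zacc-top : ∀ {D : Diagram n} {X lo x} → kind D x ≡ top → ZAcc D X lo x →
    ∀ e → lo ≤ toℕ e → lookup X e ≡ false
  zacc-top k (zend k' g) = g
  zacc-top k (z0 k' _ _ _ _) = ⊥-elim (top≢inner k k')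
  zacc-top k (z1 k' _ _ _ _) = ⊥-elim (top≢inner k k')

  zacc-inv : ∀ {D : Diagram n} {X lo x ℓ a b} → kind D x ≡ inner ℓ a b → ZAcc D X lo x →
    (lo ≤ toℕ ℓ) × Gap X lo (toℕ ℓ) ×
    ((lookup X ℓ ≡ false × ZAcc D X (suc (toℕ ℓ)) a) ⊎ (lookup X ℓ ≡ true × ZAcc D X (suc (toℕ ℓ)) b))
  zacc-inv k (zend k' _) = ⊥-elim (top≢inner k' k)
  zacc-inv k (z0 k' le g l acc) with inner-unique k' k
  ... | refl , refl , refl = le , g , inj₁ (l , acc)
  zacc-inv k (z1 k' le g l acc) with inner-unique k' k
  ... | refl , refl , refl = le , g , inj₂ (l , acc)

  zacc-inv0 : ∀ {D : Diagram n} {X lo x ℓ a b} → kind D x ≡ inner ℓ a b → ZAcc D X lo x →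
    lookup X ℓ ≡ false → ZAcc D X (suc (toℕ ℓ)) a
  zacc-inv0 k acc l with zacc-inv k acc
  ... | _ , _ , inj₁ (_ , acc') = acc'
  ... | _ , _ , inj₂ (l' , _) = ⊥-elim (bool-clash l' l)

  zacc-inv1 : ∀ {D : Diagram n} {X lo x ℓ a b} → kind D x ≡ inner ℓ a b → ZAcc D X lo x →
    lookup X ℓ ≡ true → ZAcc D X (suc (toℕ ℓ)) b
  zacc-inv1 k acc l with zacc-inv k acc
  ... | _ , _ , inj₂ (_ , acc') = acc'
  ... | _ , _ , inj₁ (l' , _) = ⊥-elim (bool-clash l l')

  bpath⇒zacc : ∀ {D : Diagram n} {u Y Z} → Ordered D → Reach D u → BPath D u Y Z →
    ∀ lo → lo ≤ rk D u → ZAcc D Y lo u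
  bpath⇒zacc o r (end k) lo le = zend k (λ e _ → lookup-∅ e)
  bpath⇒zacc {D} o r (arc0 {ℓ = ℓ} {a} k p) lo le =
    z0 k le' (λ e l1 l2 → nb e z≤n (NP.<-trans l2 lta)) (nb ℓ z≤n lta) (ih (suc (toℕ ℓ)) lta)
    where
    le' = subst (lo ≤_) (rank-inner k) le
    lta = proj₁ (o _ _ _ _ r k)
    ih = bpath⇒zacc o (reach-0 r k) p
    nb = zacc-gap (ih 0 z≤n)
  bpath⇒zacc {D} {Y = Y'} o r (arc1 {ℓ = ℓ} {b = b} {Y} k p) lo le =
    z1 k le' gp (trans (lookup-∪ ⁅ ℓ ⁆ Y ℓ) (cong (_∨ lookup Y ℓ) (lookup-⁅⁆ ℓ)))
       (zacc-local ag (ih (suc (toℕ ℓ)) ltb))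
    where
    le' = subst (lo ≤_) (rank-inner k) le
    ltb = proj₂ (o _ _ _ _ r k)
    ih = bpath⇒zacc o (reach-1 r k) p
    nb = zacc-gap (ih 0 z≤n)
    gp : Gap (⁅ ℓ ⁆ ∪ Y) lo (toℕ ℓ)
    gp e l1 l2 rewrite lookup-∪ ⁅ ℓ ⁆ Y e | lookup-⁅⁆-other {e = ℓ} {e' = e} (toℕ≢⇒≢ (λ eq → NP.<-irrefl eq l2)) =
      nb e z≤n (NP.<-trans l2 ltb)
    ag : AgreeFrom (suc (toℕ ℓ)) Y (⁅ ℓ ⁆ ∪ Y)
    ag e l rewrite lookup-∪ ⁅ ℓ ⁆ Y e | lookup-⁅⁆-other {e = ℓ} {e' = e} (toℕ≢⇒≢ (λ eq → NP.<-irrefl (sym eq) l)) =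
      refl

  zacc⇒bpath : ∀ {D : Diagram n} {X lo u} → ZAcc D X lo u →
    Σ (Subset n) λ Y → Σ (Subset n) λ Z → BPath D u Y Z ×
    (∀ e → lo ≤ toℕ e → lookup Y e ≡ lookup X e) × (∀ e → toℕ e < lo → lookup Y e ≡ false)
  zacc⇒bpath (zend k g) = ∅ , ∅ , end k , (λ e l → trans (lookup-∅ e) (sym (g e l))) , (λ e _ → lookup-∅ e)
  zacc⇒bpath {X = X} {lo} (z0 {ℓ = ℓ} k le g l acc) with zacc⇒bpath acc
  ... | Y , Z , p , eqF , zB =
    Y , ⁅ ℓ ⁆ ∪ Z , arc0 k p , eqF' , (λ e lt → zB e (NP.<-≤-trans lt (NP.≤-trans le (NP.n≤1+n _))))
    where
    eqF' : ∀ e → lo ≤ toℕ e → lookup Y e ≡ lookup X e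
    eqF' e l1 with NP.<-cmp (toℕ e) (toℕ ℓ)
    ... | tri< lt _ _ = trans (zB e (NP.m<n⇒m<1+n lt)) (sym (g e l1 lt))
    ... | tri≈ _ eq _ with FP.toℕ-injective eq
    ...   | refl = trans (zB e (NP.n<1+n _)) (sym l)
    eqF' e l1 | tri> _ _ gt = eqF e gt
  zacc⇒bpath {X = X} {lo} (z1 {ℓ = ℓ} k le g l acc) with zacc⇒bpath acc
  ... | Y , Z , p , eqF , zB = ⁅ ℓ ⁆ ∪ Y , Z , arc1 k p , eqF' , zB'
    where
    eqF' : ∀ e → lo ≤ toℕ e → lookup (⁅ ℓ ⁆ ∪ Y) e ≡ lookup X e
    eqF' e l1 rewrite lookup-∪ ⁅ ℓ ⁆ Y e with NP.<-cmp (toℕ e) (toℕ ℓ)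
    ... | tri< lt _ _ rewrite lookup-⁅⁆-other {e = ℓ} {e' = e} (toℕ≢⇒≢ (λ eq → NP.<-irrefl eq lt)) =
      trans (zB e (NP.m<n⇒m<1+n lt)) (sym (g e l1 lt))
    ... | tri≈ _ eq _ with FP.toℕ-injective eq
    ...   | refl rewrite lookup-⁅⁆ e = sym l
    eqF' e l1 | tri> _ _ gt rewrite lookup-⁅⁆-other {e = ℓ} {e' = e} (toℕ≢⇒≢ (λ eq → NP.<-irrefl (sym eq) gt)) =
      eqF e gt
    zB' : ∀ e → toℕ e < lo → lookup (⁅ ℓ ⁆ ∪ Y) e ≡ false
    zB' e lt rewrite lookup-∪ ⁅ ℓ ⁆ Y e
                   | lookup-⁅⁆-other {e = ℓ} {e' = e} (toℕ≢⇒≢ (λ eq → NP.<-irrefl eq (NP.<-≤-trans lt le))) =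
      zB e (NP.<-≤-trans lt (NP.≤-trans le (NP.n≤1+n _)))

  zsem→zacc : ∀ {D : Diagram n} {X} → Ordered D → ZSem D X → ZAcc D X 0 (root D)
  zsem→zacc o (Z , p) = bpath⇒zacc o reach-root p 0 z≤n

  zacc→zsem : ∀ {D : Diagram n} {X} → ZAcc D X 0 (root D) → ZSem D X
  zacc→zsem {X = X} acc with zacc⇒bpath acc
  ... | Y , Z , p , eqF , _ = Z , subst (λ W → BPath _ _ W Z) (subset-ext Y X (λ e → eqF e z≤n)) p

  gap? : ∀ X lo hi → Dec (Gap X lo hi)
  gap? X lo hi = FP.all? (λ e → (lo ≤? toℕ e) →-dec ((toℕ e <? hi) →-dec (lookup X e BP.≟ false)))

  gapB : Subset n → ℕ → ℕ → Bool
  gapB X lo hi = does (gap? X lo hi)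

  does⇒ : ∀ {P : Set} (d : Dec P) → does d ≡ true → P
  does⇒ (yes p) _ = p
  does⇒ (no _) ()

  ⇒does : ∀ {P : Set} (d : Dec P) → P → does d ≡ true
  ⇒does (yes _) _ = refl
  ⇒does (no np) p = ⊥-elim (np p)

  gapB-correct : ∀ X lo hi → (gapB X lo hi ≡ true → Gap X lo hi) × (Gap X lo hi → gapB X lo hi ≡ true)
  gapB-correct X lo hi = does⇒ (gap? X lo hi) , ⇒does (gap? X lo hi)

  ∧≡true⁻ : ∀ {b c : Bool} → (b ∧ c) ≡ true → (b ≡ true) × (c ≡ true)
  ∧≡true⁻ {true} {true} _ = refl , refl
  ∧≡true⁻ {true} {false} ()
  ∧≡true⁻ {false} ()

  mutual
    evZ : (D : Diagram n) → ℕ → ℕ → Node D → Subset n → Bool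
    evZ D zero lo u X = false
    evZ D (suc f) lo u X = evZK D f lo (kind D u) X

    evZK : (D : Diagram n) → ℕ → ℕ → Kind (Node D) n → Subset n → Bool
    evZK D f lo bot X = false
    evZK D f lo top X = gapB X lo n
    evZK D f lo (inner ℓ a b) X =
      does (lo ≤? toℕ ℓ) ∧
      (gapB X lo (toℕ ℓ) ∧ (if lookup X ℓ then evZ D f (suc (toℕ ℓ)) b X else evZ D f (suc (toℕ ℓ)) a X))

  evZ-correct : ∀ {D : Diagram n} → Ordered D → ∀ m lo {u} X → Reach D u → n ≤ m + rk D u →
    (evZ D (suc m) lo u X ≡ true → ZAcc D X lo u) × (ZAcc D X lo u → evZ D (suc m) lo u X ≡ true)
  evZ-correct {D} o m lo {u} X r h = aux m (kind D u) refl h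
    where
    aux : ∀ m kk → kind D u ≡ kk → n ≤ m + rk D u →
      (evZK D m lo kk X ≡ true → ZAcc D X lo u) × (ZAcc D X lo u → evZK D m lo kk X ≡ true)
    aux m bot k h = (λ ()) , (λ acc → ⊥-elim (zacc-bot k acc))
    aux m top k h = (λ e → zend k (λ e' le → proj₁ (gapB-correct X lo n) e e' le (FP.toℕ<n e'))) ,
                    (λ acc → proj₂ (gapB-correct X lo n) (λ e le _ → zacc-top k acc e le))
    aux zero (inner ℓ a b) k h = ⊥-elim (no-inner-without-budget h k)
    aux (suc m) (inner ℓ a b) k h with lookup X ℓ in l
    ... | true =
      (λ e → let p = ∧≡true⁻ e ; q = ∧≡true⁻ (proj₂ p) in
        z1 k (does⇒ (lo ≤? toℕ ℓ) (proj₁ p)) (does⇒ (gap? X lo (toℕ ℓ)) (proj₁ q)) l (proj₁ ih (proj₂ q))) ,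
      (λ acc → let w = zacc-inv k acc in
        cong₂ _∧_ (⇒does (lo ≤? toℕ ℓ) (proj₁ w))
                  (cong₂ _∧_ (⇒does (gap? X lo (toℕ ℓ)) (proj₁ (proj₂ w))) (proj₂ ih (zacc-inv1 k acc l))))
      where ih = evZ-correct o m (suc (toℕ ℓ)) X (reach-1 r k)
                   (budget-step (subst (λ z → n ≤ suc m + z) (rank-inner k) h) (proj₂ (o _ _ _ _ r k)))
    ... | false =
      (λ e → let p = ∧≡true⁻ e ; q = ∧≡true⁻ (proj₂ p) in
        z0 k (does⇒ (lo ≤? toℕ ℓ) (proj₁ p)) (does⇒ (gap? X lo (toℕ ℓ)) (proj₁ q)) l (proj₁ ih (proj₂ q))) ,
      (λ acc → let w = zacc-inv k acc in
        cong₂ _∧_ (⇒does (lo ≤? toℕ ℓ) (proj₁ w))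
                  (cong₂ _∧_ (⇒does (gap? X lo (toℕ ℓ)) (proj₁ (proj₂ w))) (proj₂ ih (zacc-inv0 k acc l))))
      where ih = evZ-correct o m (suc (toℕ ℓ)) X (reach-0 r k)
                   (budget-step (subst (λ z → n ≤ suc m + z) (rank-inner k) h) (proj₁ (o _ _ _ _ r k)))

module _ {n : ℕ} where

  ZS : (E : Diagram n) → Node E → Subset n → Set
  ZS E u X = ZAcc E X 0 u

  evZS : (E : Diagram n) → Node E → Subset n → Bool
  evZS E u X = evZ E (suc n) 0 u X

  ZEquiv : (E1 : Diagram n) → Node E1 → (E2 : Diagram n) → Node E2 → Set
  ZEquiv E1 x E2 y = ∀ X → (ZAcc E1 X 0 x → ZAcc E2 X 0 y) × (ZAcc E2 X 0 y → ZAcc E1 X 0 x)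

  ZReduced : Diagram n → Set
  ZReduced D = WellFormed D × NSFree D × ZNDFree D


module ZNonEmpty {n : ℕ} (D : Diagram n) (R : ZReduced D) where
  private
    o = ordered {D = D} (proj₁ R)

  -- By (Z-ND) the 1-child is not ⊥, so it accepts some set, and adding ℓ to it gives one for u.
  witness : ∀ m u ℓ c d → Reach D u → n ≤ m + rk D u → kind D u ≡ inner ℓ c d →
    Σ (Subset n) λ C → ZAcc D C 0 u × lookup C ℓ ≡ true
  accepts-some : ∀ m u → Reach D u → n ≤ m + rk D u → kind D u ≢ bot →
    Σ (Subset n) λ C → ZAcc D C 0 u

  witness zero u ℓ c d r h k = ⊥-elim (no-inner-without-budget h k)
  witness (suc m) u ℓ c d r h k
    with accepts-some m d (reach-1 r k) (budget-step h' ltd) (proj₂ (proj₂ R) u ℓ c d r k)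
    where h' = subst (λ w → n ≤ suc m + w) (rank-inner k) h
          ltd = proj₂ (o _ _ _ _ r k)
  ... | C' , acc = C , z1 k z≤n gp (lookup-≔ C' ℓ true) (zacc-local ag (zacc-raise acc z≤n ltd)) ,
                   lookup-≔ C' ℓ true
    where
    ltd = proj₂ (o _ _ _ _ r k)
    C = C' [ ℓ ]≔ true
    gp : Gap C 0 (toℕ ℓ)
    gp e _ lt = trans (lookup-≔-other C' true (toℕ≢⇒≢ (λ eq → NP.<-irrefl eq lt)))
                      (zacc-gap acc e z≤n (NP.<-trans lt ltd))
    ag : AgreeFrom (suc (toℕ ℓ)) C' C
    ag e le = sym (lookup-≔-other C' true (toℕ≢⇒≢ (λ eq → NP.<-irrefl (sym eq) le)))

  accepts-some m u r h nb with kind-view D u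
  ... | inj₁ k = ∅ , zend k (λ e _ → lookup-∅ e)
  ... | inj₂ (inj₁ k) = ⊥-elim (nb k)
  ... | inj₂ (inj₂ (ℓ , c , d , k)) with witness m u ℓ c d r h k
  ...   | C , acc , _ = C , acc

module ZShape {n : ℕ} (D1 D2 : Diagram n) (R1 : ZReduced D1) (R2 : ZReduced D2) where
  o1 = ordered {D = D1} (proj₁ R1)
  o2 = ordered {D = D2} (proj₁ R2)

  witness : ∀ {E : Diagram n} → ZReduced E → ∀ {u ℓ c d} → Reach E u → kind E u ≡ inner ℓ c d →
    Σ (Subset n) λ C → ZAcc E C 0 u × lookup C ℓ ≡ true
  witness {E} R {u} {ℓ} {c} {d} r k = ZNonEmpty.witness E R n u ℓ c d r (NP.m≤m+n n _) k

  label≤member : ∀ {E : Diagram n} {u ℓ c d C e} → kind E u ≡ inner ℓ c d → ZAcc E C 0 u →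
    lookup C e ≡ true → toℕ ℓ ≤ toℕ e
  label≤member {ℓ = ℓ} {e = e} k acc l with toℕ e <? toℕ ℓ
  ... | yes lt = ⊥-elim (bool-clash l (proj₁ (proj₂ (zacc-inv k acc)) e z≤n lt))
  ... | no nlt = NP.≮⇒≥ nlt

  child₀-transfer : ∀ {E1 E2 : Diagram n} {x y ℓ a b c d} → Ordered E1 → Reach E1 x →
    kind E1 x ≡ inner ℓ a b → kind E2 y ≡ inner ℓ c d →
    (∀ X → ZAcc E1 X 0 x → ZAcc E2 X 0 y) → ∀ X → ZAcc E1 X 0 a → ZAcc E2 X 0 c
  child₀-transfer {ℓ = ℓ} o rx kx ky f X acc =
    zacc-lower (zacc-inv0 ky accy lℓ) z≤n gp'
    where
    lta = proj₁ (o _ _ _ _ rx kx)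
    nb = zacc-gap acc
    lℓ : lookup X ℓ ≡ false
    lℓ = nb ℓ z≤n lta
    accy = f X (z0 kx z≤n (λ e _ lt → nb e z≤n (NP.<-trans lt lta)) lℓ (zacc-raise acc z≤n lta))
    gp' : Gap X 0 (suc (toℕ ℓ))
    gp' e _ lt = nb e z≤n (NP.<-≤-trans lt lta)

  child₁-transfer : ∀ {E1 E2 : Diagram n} {x y ℓ a b c d} → Ordered E1 → Reach E1 x →
    kind E1 x ≡ inner ℓ a b → kind E2 y ≡ inner ℓ c d →
    (∀ X → ZAcc E1 X 0 x → ZAcc E2 X 0 y) → ∀ X → ZAcc E1 X 0 b → ZAcc E2 X 0 d
  child₁-transfer {ℓ = ℓ} o rx kx ky f X acc =
    zacc-lower (zacc-local ag' (zacc-inv1 ky accy (lookup-≔ X ℓ true))) z≤n gp'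
    where
    ltb = proj₂ (o _ _ _ _ rx kx)
    nb = zacc-gap acc
    X1 = X [ ℓ ]≔ true
    ag : AgreeFrom (suc (toℕ ℓ)) X X1
    ag e le = sym (lookup-≔-other X true (toℕ≢⇒≢ (λ eq → NP.<-irrefl (sym eq) le)))
    ag' : AgreeFrom (suc (toℕ ℓ)) X1 X
    ag' e le = sym (ag e le)
    accy = f X1 (z1 kx z≤n (λ e _ lt → trans (lookup-≔-other X true (toℕ≢⇒≢ (λ eq → NP.<-irrefl eq lt)))
                                             (nb e z≤n (NP.<-trans lt ltb)))
                  (lookup-≔ X ℓ true) (zacc-local ag (zacc-raise acc z≤n ltb)))
    gp' : Gap X 0 (suc (toℕ ℓ))
    gp' e _ lt = nb e z≤n (NP.<-≤-trans lt ltb)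

  -- The label of an inner node is a lower bound for the sets it accepts, and it is attained
  -- (witness); so equivalent inner nodes carry the same label.
  shape : ∀ x y → Reach D1 x → Reach D2 y → ZEquiv D1 x D2 y → Canonical.SameShape ZS evZS D1 D2 x y
  shape x y rx ry se = ftop , fbot , finner
    where
    ∅acc : ∀ {E : Diagram n} {z} → kind E z ≡ top → ZAcc E ∅ 0 z
    ∅acc k = zend k (λ e _ → lookup-∅ e)
    ftop : kind D1 x ≡ top → kind D2 y ≡ top
    ftop kx with kind-view D2 y
    ... | inj₁ ky = ky
    ... | inj₂ (inj₁ ky) = ⊥-elim (zacc-bot ky (proj₁ (se ∅) (∅acc kx)))
    ... | inj₂ (inj₂ (ℓ , c , d , ky)) with witness R2 ry ky
    ...   | C , acc , l = ⊥-elim (bool-clash l (zacc-top kx (proj₂ (se C) acc) ℓ z≤n))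
    fbot : kind D1 x ≡ bot → kind D2 y ≡ bot
    fbot kx with kind-view D2 y
    ... | inj₂ (inj₁ ky) = ky
    ... | inj₁ ky = ⊥-elim (zacc-bot kx (proj₂ (se ∅) (∅acc ky)))
    ... | inj₂ (inj₂ (ℓ , c , d , ky)) with witness R2 ry ky
    ...   | C , acc , l = ⊥-elim (zacc-bot kx (proj₂ (se C) acc))
    finner : ∀ ℓ a b → kind D1 x ≡ inner ℓ a b → Σ (Node D2) λ c → Σ (Node D2) λ d →
      kind D2 y ≡ inner ℓ c d × ZEquiv D1 a D2 c × ZEquiv D1 b D2 d
    finner ℓ a b kx with witness R1 rx kx
    ... | Cx , accx , lx with kind-view D2 y
    ...   | inj₁ ky = ⊥-elim (bool-clash lx (zacc-top ky (proj₁ (se Cx) accx) ℓ z≤n))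
    ...   | inj₂ (inj₁ ky) = ⊥-elim (zacc-bot ky (proj₁ (se Cx) accx))
    ...   | inj₂ (inj₂ (ℓ' , c , d , ky)) with witness R2 ry ky
    ...     | Cy , accy , ly
      with FP.toℕ-injective (NP.≤-antisym (label≤member kx (proj₂ (se Cy) accy) ly)
                                          (label≤member ky (proj₁ (se Cx) accx) lx))
    ...       | refl = c , d , ky ,
      (λ X → child₀-transfer o1 rx kx ky (λ X → proj₁ (se X)) X ,
             child₀-transfer o2 ry ky kx (λ X → proj₂ (se X)) X) ,
      (λ X → child₁-transfer o1 rx kx ky (λ X → proj₁ (se X)) X ,
             child₁-transfer o2 ry ky kx (λ X → proj₂ (se X)) X)

ZDD-canonical : ∀ {n} (D1 D2 : Diagram n) → ZReduced D1 → ZReduced D2 →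
  ZEquiv D1 (root D1) D2 (root D2) → D1 ≅ D2
ZDD-canonical {n} D1 D2 R1 R2 se =
  Canonical.Construction.iso ZS evZS D1 D2
    (λ X r → evZ-correct o1 n 0 X r (NP.m≤m+n n _))
    (λ X r → evZ-correct o2 n 0 X r (NP.m≤m+n n _))
    o2
    (ZShape.shape D1 D2 R1 R2)
    (unique D1 R1)
    (unique D2 R2)
    se
  where
  o1 = ordered {D = D1} (proj₁ R1)
  o2 = ordered {D = D2} (proj₁ R2)
  unique : ∀ D → ZReduced D → ∀ x y → Reach D x → Reach D y → ZEquiv D x D y → x ≡ y
  unique D R x y rx ry = UniqueUpToEquivalence.equivalent⇒equal ZS D (proj₁ R) (proj₁ (proj₂ R)) n
    (λ x y rx ry _ _ → ZShape.shape D D R R x y rx ry) x y rx ry (NP.m≤m+n n _) (NP.m≤m+n n _)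

module ZRedirection {n : ℕ} (D : Diagram n) (v t : Node D) where
  open Redirection D v t

  zacc-r⁻ : (∀ X lo → lo ≤ rk D v → ZAcc D X lo t → ZAcc D X lo v) →
    ∀ {X lo y} → lo ≤ rk D y → ZAcc D X lo (r y) → ZAcc D X lo y
  zacc-r⁻ h {X} {lo} {y} le acc with r-cases y
  ... | inj₁ (refl , e) = h X lo le (subst (ZAcc D X lo) e acc)
  ... | inj₂ (_ , e) = subst (ZAcc D X lo) e acc

  zacc-redirect⁻ : Ordered D → Reach D t → (∀ X lo → lo ≤ rk D v → ZAcc D X lo t → ZAcc D X lo v) →
           ∀ {X lo x} → Reach D x → ZAcc R X lo x → ZAcc D X lo x
  zacc-redirect⁻ o rt h {X} {lo} {x} rx (zend k g) = zend (mapKind-top⁻ {f = r} {k = kind D x} k) g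
  zacc-redirect⁻ o rt h {X} {lo} {x} rx (z0 k le g l acc) with mapKind-inner⁻ {f = r} {k = kind D x} k
  ... | a , b , k' , refl , refl =
    z0 k' le g l (zacc-r⁻ h (proj₁ (o _ _ _ _ rx k')) (zacc-redirect⁻ o rt h (reach-r rt (reach-0 rx k')) acc))
  zacc-redirect⁻ o rt h {X} {lo} {x} rx (z1 k le g l acc) with mapKind-inner⁻ {f = r} {k = kind D x} k
  ... | a , b , k' , refl , refl =
    z1 k' le g l (zacc-r⁻ h (proj₂ (o _ _ _ _ rx k')) (zacc-redirect⁻ o rt h (reach-r rt (reach-1 rx k')) acc))

  zacc-redirect-merged : kind D t ≡ kind D v → ∀ {X lo x} → ZAcc D X lo x → ZAcc R X lo (r x)
  zacc-redirect-merged kt {X} = go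
    where
    kr : ∀ y → kind D (r y) ≡ kind D y
    kr y with r-cases y
    ... | inj₁ (refl , e) = trans (cong (kind D) e) kt
    ... | inj₂ (_ , e) = cong (kind D) e
    go : ∀ {lo x} → ZAcc D X lo x → ZAcc R X lo (r x)
    go {lo} {x} (zend k g) = zend (cong (mapKind r) (trans (kr x) k)) g
    go {lo} {x} (z0 k le g l acc) = z0 (cong (mapKind r) (trans (kr x) k)) le g l (go acc)
    go {lo} {x} (z1 k le g l acc) = z1 (cong (mapKind r) (trans (kr x) k)) le g l (go acc)

  zacc-redirect-skipped : ∀ {ℓv bz} → Ordered D → Reach D v → kind D v ≡ inner ℓv t bz → kind D bz ≡ bot →
             ∀ {X lo x} → ZAcc D X lo x → ZAcc R X lo (r x)
  zacc-redirect-skipped {ℓv} {bz} o rv kv kb {X} = go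
    where
    ltt = proj₁ (o _ _ _ _ rv kv)
    t≢v : t ≢ v
    t≢v e = NP.<-irrefl (sym (rank-inner kv)) (subst (λ z → toℕ ℓv < rk D z) e ltt)
    rt : r t ≡ t
    rt with r-cases t
    ... | inj₁ (e , _) = ⊥-elim (t≢v e)
    ... | inj₂ (_ , e) = e
    go : ∀ {lo x} → ZAcc D X lo x → ZAcc R X lo (r x)
    go {lo} {x} acc with r-cases x
    go {lo} {x} (zend k g) | inj₁ (refl , e) = ⊥-elim (top≢inner k kv)
    go {lo} {x} (z1 k le g l acc) | inj₁ (refl , e) with inner-unique k kv
    ... | refl , refl , refl = ⊥-elim (zacc-bot kb acc)
    go {lo} {x} (z0 k le g l acc) | inj₁ (refl , e) with inner-unique k kv
    ... | refl , refl , refl =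
      subst (ZAcc R X lo) (trans rt (sym e)) (zacc-lower (go acc) (NP.≤-trans le (NP.n≤1+n _)) gp)
      where
      gp : Gap X lo (suc (toℕ ℓv))
      gp e' l1 l2 with toℕ e' <? toℕ ℓv
      ... | yes lt = g e' l1 lt
      ... | no nlt =
        subst (λ z → lookup X z ≡ false) (sym (FP.toℕ-injective (NP.≤-antisym (NP.≤-pred l2) (NP.≮⇒≥ nlt)))) l
    go {lo} {x} (zend k g) | inj₂ (ne , e) = subst (ZAcc R X lo) (sym e) (zend (cong (mapKind r) k) g)
    go {lo} {x} (z0 k le g l acc) | inj₂ (ne , e) =
      subst (ZAcc R X lo) (sym e) (z0 (cong (mapKind r) k) le g l (go acc))
    go {lo} {x} (z1 k le g l acc) | inj₂ (ne , e) =
      subst (ZAcc R X lo) (sym e) (z1 (cong (mapKind r) k) le g l (go acc))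

module _ {n : ℕ} where

  zacc-same : ∀ {D : Diagram n} {X lo x y} → kind D x ≡ kind D y → ZAcc D X lo x → ZAcc D X lo y
  zacc-same e (zend k g) = zend (trans (sym e) k) g
  zacc-same e (z0 k le g l acc) = z0 (trans (sym e) k) le g l acc
  zacc-same e (z1 k le g l acc) = z1 (trans (sym e) k) le g l acc

  ZEquiv-refl : ∀ {D : Diagram n} {x} → ZEquiv D x D x
  ZEquiv-refl X = (λ a → a) , (λ a → a)

  ZEquiv-trans : ∀ {D1 D2 D3 : Diagram n} {x y z} → ZEquiv D1 x D2 y → ZEquiv D2 y D3 z → ZEquiv D1 x D3 z
  ZEquiv-trans s t X = (λ p → proj₁ (t X) (proj₁ (s X) p)) , (λ p → proj₂ (s X) (proj₂ (t X) p))

  ZStep-sound : ∀ {D D' : Diagram n} → ZStep D D' → WellFormed D →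
    WellFormed D' × ZEquiv D (root D) D' (root D')
  ZStep-sound {D} (step-ns (ns u v ℓ a b ru rv ne ku kv)) w =
    redirect-wellFormed w ru (NP.≤-reflexive (cong rank (trans kv (sym ku)))) ,
    λ X → (λ acc → zacc-redirect-merged (trans ku (sym kv)) acc) ,
          (λ acc → zacc-r⁻ h z≤n (zacc-redirect⁻ o ru h (reach-r ru reach-root) acc))
    where
    open Redirection D v u
    open ZRedirection D v u
    o = ordered {D = D} w
    h : ∀ X lo → lo ≤ rk D v → ZAcc D X lo u → ZAcc D X lo v
    h X lo _ = zacc-same (trans ku (sym kv))
  ZStep-sound {D} (step-znd (znd ν ℓ a b rν k kb)) w =
    redirect-wellFormed w ra (NP.<⇒≤ (subst (_< rk D a) (sym (rank-inner k)) lta)) ,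
    λ X → (λ acc → zacc-redirect-skipped o rν k kb acc) ,
          (λ acc → zacc-r⁻ h z≤n (zacc-redirect⁻ o ra h (reach-r ra reach-root) acc))
    where
    open Redirection D ν a
    open ZRedirection D ν a
    o = ordered {D = D} w
    ra = reach-0 rν k
    lta = proj₁ (o _ _ _ _ rν k)
    h : ∀ X lo → lo ≤ rk D ν → ZAcc D X lo a → ZAcc D X lo ν
    h X lo le acc = z0 k le' (λ e l1 l2 → nb e l1 (NP.<-trans l2 lta)) (nb ℓ le' lta)
                      (zacc-raise acc (NP.≤-trans le' (NP.n≤1+n _)) lta)
      where
      le' = subst (lo ≤_) (rank-inner k) le
      nb = zacc-gap acc

  ZSteps-sound : ∀ {D D' : Diagram n} → Star ZStep D D' → WellFormed D →
    WellFormed D' × ZEquiv D (root D) D' (root D')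
  ZSteps-sound ε w = w , ZEquiv-refl
  ZSteps-sound (s ◅ ss) w with ZStep-sound s w
  ... | w' , se with ZSteps-sound ss w'
  ...   | w'' , se' = w'' , ZEquiv-trans se se'

module CompleteTreeZ {n : ℕ} (S : Family n) where
  open CompleteTree S

  tree-ZAcc : ∀ m j P X lo → m + j ≡ n → lo ≤ j →
    (ZAcc T X lo (nodeAt S j P) → Mem S (splice j P X) × Gap X lo j) ×
    (Mem S (splice j P X) → Gap X lo j → ZAcc T X lo (nodeAt S j P))
  tree-ZAcc m j P X lo e le = go m e (j <? n)
    where
    go : ∀ m → m + j ≡ n → Dec (j < n) →
      (ZAcc T X lo (nodeAt S j P) → Mem S (splice j P X) × Gap X lo j) ×
      (Mem S (splice j P X) → Gap X lo j → ZAcc T X lo (nodeAt S j P))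
    go zero refl (yes lt) = ⊥-elim (NP.<-irrefl refl lt)
    go (suc m) e (yes lt) rewrite nodeAt-yes {j} {P} lt = fwd , bwd
      where
      ℓ = fromℕ< lt
      tl : toℕ ℓ ≡ j
      tl = FP.toℕ-fromℕ< lt
      kt = treeKind-yes {j} {P} lt
      ih : ∀ v → _
      ih v = tree-ZAcc m (suc j) (P [ ℓ ]≔ v) X (suc j) (trans (NP.+-suc m j) e) NP.≤-refl
      eqv : ∀ v → lookup X ℓ ≡ v → splice (suc j) (P [ ℓ ]≔ v) X ≡ splice j P X
      eqv v l = trans (cong (λ z → splice (suc j) (P [ ℓ ]≔ z) X) (sym l)) (splice-step j P X lt)
      g0 : Gap X (suc j) (suc j)
      g0 e' l1 l2 = ⊥-elim (NP.<⇒≱ l2 l1)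
      child : Bool → TNode n
      child v = nodeAt S (suc j) (P [ ℓ ]≔ v)
      gap-ℓ : Gap X lo j → Gap X lo (toℕ ℓ)
      gap-ℓ gp e' l1 l2 = gp e' l1 (subst (toℕ e' <_) tl l2)
      fwd : ZAcc T X lo (tin j P) → Mem S (splice j P X) × Gap X lo j
      fwd acc with zacc-inv kt acc
      ... | le' , g , inj₁ (l , acc') =
        subst (Mem S) (eqv false l) (proj₁ (proj₁ (ih false) (subst (λ z → ZAcc T X (suc z) (child false)) tl acc'))) ,
        (λ e' l1 l2 → g e' l1 (subst (toℕ e' <_) (sym tl) l2))
      ... | le' , g , inj₂ (l , acc') =
        subst (Mem S) (eqv true l) (proj₁ (proj₁ (ih true) (subst (λ z → ZAcc T X (suc z) (child true)) tl acc'))) ,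
        (λ e' l1 l2 → g e' l1 (subst (toℕ e' <_) (sym tl) l2))
      bwd : Mem S (splice j P X) → Gap X lo j → ZAcc T X lo (tin j P)
      bwd mm gp with lookup X ℓ in l
      ... | false = z0 kt (subst (lo ≤_) (sym tl) le) (gap-ℓ gp) l
        (subst (λ z → ZAcc T X (suc z) (child false)) (sym tl) (proj₂ (ih false) (subst (Mem S) (sym (eqv false l)) mm) g0))
      ... | true = z1 kt (subst (lo ≤_) (sym tl) le) (gap-ℓ gp) l
        (subst (λ z → ZAcc T X (suc z) (child true)) (sym tl) (proj₂ (ih true) (subst (Mem S) (sym (eqv true l)) mm) g0))
    go m e (no ¬lt) rewrite nodeAt-no {j} {P} ¬lt with leaf-cases P
    ... | inj₁ (mm , eq) rewrite eq =
      (λ acc → subst (Mem S) (sym (splice-exhausted P X e ¬lt)) mm , (λ e' l1 _ → zacc-top refl acc e' l1)) ,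
      (λ _ gp → zend refl (λ e' l1 → gp e' l1 (subst (toℕ e' <_) (sym (exhausted e ¬lt)) (FP.toℕ<n e'))))
    ... | inj₂ (nm , eq) rewrite eq =
      (λ acc → ⊥-elim (zacc-bot refl acc)) ,
      (λ mm _ → ⊥-elim (nm (subst (Mem S) (splice-exhausted P X e ¬lt) mm)))

  tree-ZSem : ∀ X → (ZAcc T X 0 (root T) → Mem S X) × (Mem S X → ZAcc T X 0 (root T))
  tree-ZSem X =
    (λ acc → subst (Mem S) (splice-none ∅ X) (proj₁ (proj₁ root-ZAcc acc))) ,
    (λ m → proj₂ root-ZAcc (subst (Mem S) (sym (splice-none ∅ X)) m) (λ e _ lt → ⊥-elim (NP.<⇒≱ lt z≤n)))
    where root-ZAcc = tree-ZAcc n 0 ∅ X 0 (NP.+-identityʳ n) z≤n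

module ZUpdate {n : ℕ} (M : Matroid n) (D : Diagram n) (R : ZReduced D)
  (sem : ∀ X → (ZAcc D X 0 (root D) → IsBasis M X) × (IsBasis M X → ZAcc D X 0 (root D))) where
  open Update D
  open MatroidProperties M
  open ZNonEmpty D R
  o = ordered {D = D} (proj₁ R)

  -- Redirected 0-arcs are replaced by the 1-arcs they copy; the gaps below ℓ persist because X
  -- and X' agree there.
  update-zacc⇒superset-zacc : ∀ {X lo u} → ZAcc U X lo u → Reach D u →
    Σ (Subset n) λ X' → X ⊆ X' × AgreeBelow lo X X' × ZAcc D X' lo u
  update-zacc⇒superset-zacc {X} (zend k g) r = X , (λ z → z) , (λ _ _ → refl) , zend (update-top⁻ k) g
  update-zacc⇒superset-zacc {X} {lo} {u} (z0 {ℓ = ℓ} k le g l acc) r with update-inner⁻ k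
  ... | a , k' , inj₁ (ka , refl) with update-zacc⇒superset-zacc acc (reach-1 r k')
  ...   | X' , X⊆X' , agree , acc' =
    X' [ ℓ ]≔ true , ⊆-≔true X⊆X' , agree' , z1 k' le gap' (lookup-≔ X' ℓ true) (zacc-local above acc')
    where
    ≢ℓ : ∀ {e} → toℕ e < toℕ ℓ → e ≢ ℓ
    ≢ℓ lt = toℕ≢⇒≢ (NP.<⇒≢ lt)
    gap' : Gap (X' [ ℓ ]≔ true) lo (toℕ ℓ)
    gap' e l1 l2 = trans (lookup-≔-other X' true (≢ℓ l2)) (trans (sym (agree e (NP.m<n⇒m<1+n l2))) (g e l1 l2))
    agree' : AgreeBelow lo X (X' [ ℓ ]≔ true)
    agree' e lt = trans (agree e (NP.m<n⇒m<1+n (NP.<-≤-trans lt le)))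
                        (sym (lookup-≔-other X' true (≢ℓ (NP.<-≤-trans lt le))))
    above : AgreeFrom (suc (toℕ ℓ)) X' (X' [ ℓ ]≔ true)
    above e l' = sym (lookup-≔-other X' true (toℕ≢⇒≢ (λ eq → NP.<-irrefl (sym eq) l')))
  update-zacc⇒superset-zacc {X} {lo} {u} (z0 {ℓ = ℓ} k le g l acc) r | a , k' , inj₂ (ka , refl)
    with update-zacc⇒superset-zacc acc (reach-0 r k')
  ... | X' , X⊆X' , agree , acc' =
    X' , X⊆X' , (λ e lt → agree e (NP.m<n⇒m<1+n (NP.<-≤-trans lt le))) ,
    z0 k' le (λ e l1 l2 → trans (sym (agree e (NP.m<n⇒m<1+n l2))) (g e l1 l2)) (trans (sym (agree ℓ (NP.n<1+n _))) l) acc'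
  update-zacc⇒superset-zacc {X} {lo} {u} (z1 {ℓ = ℓ} k le g l acc) r with update-inner⁻ k
  ... | a , k' , _ with update-zacc⇒superset-zacc acc (reach-1 r k')
  ...   | X' , X⊆X' , agree , acc' =
    X' , X⊆X' , (λ e lt → agree e (NP.m<n⇒m<1+n (NP.<-≤-trans lt le))) ,
    z1 k' le (λ e l1 l2 → trans (sym (agree e (NP.m<n⇒m<1+n l2))) (g e l1 l2)) (trans (sym (agree ℓ (NP.n<1+n _))) l) acc'

  soundZ : ∀ {X} → ZAcc U X 0 (root D) → Indep M X
  soundZ {X} acc with update-zacc⇒superset-zacc acc reach-root
  ... | X' , X⊆X' , _ , acc' = hereditary M X' X X⊆X' (proj₁ (proj₁ (sem X') acc'))

  PrefixZ : Node D → ℕ → Subset n → Set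
  PrefixZ u lo B = ∀ B' → AgreeBelow lo B B' →
    (ZAcc D B' 0 (root D) → ZAcc D B' lo u) × (ZAcc D B' lo u → ZAcc D B' 0 (root D))

  prefixZ-≈ : ∀ {u lo B B2} → PrefixZ u lo B → AgreeBelow lo B B2 → PrefixZ u lo B2
  prefixZ-≈ p ag B' ag' = p B' (λ e lt → trans (ag e lt) (ag' e lt))

  prefixZ-child₀ : ∀ {u lo B ℓ a b} → PrefixZ u lo B → kind D u ≡ inner ℓ a b → lo ≤ toℕ ℓ →
    Gap B lo (toℕ ℓ) → lookup B ℓ ≡ false → PrefixZ a (suc (toℕ ℓ)) B
  prefixZ-child₀ {u} {lo} {B} {ℓ} p k le gB l B' ag =
    (λ acc → zacc-inv0 k (proj₁ (p B' ag') acc) l') , (λ acc → proj₂ (p B' ag') (z0 k le g' l' acc))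
    where
    ag' : AgreeBelow lo B B'
    ag' e lt = ag e (NP.m<n⇒m<1+n (NP.<-≤-trans lt le))
    l' : lookup B' ℓ ≡ false
    l' = trans (sym (ag ℓ (NP.n<1+n _))) l
    g' : Gap B' lo (toℕ ℓ)
    g' e l1 l2 = trans (sym (ag e (NP.m<n⇒m<1+n l2))) (gB e l1 l2)

  prefixZ-child₁ : ∀ {u lo B ℓ a b} → PrefixZ u lo B → kind D u ≡ inner ℓ a b → lo ≤ toℕ ℓ →
    Gap B lo (toℕ ℓ) → lookup B ℓ ≡ true → PrefixZ b (suc (toℕ ℓ)) B
  prefixZ-child₁ {u} {lo} {B} {ℓ} p k le gB l B' ag =
    (λ acc → zacc-inv1 k (proj₁ (p B' ag') acc) l') , (λ acc → proj₂ (p B' ag') (z1 k le g' l' acc))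
    where
    ag' : AgreeBelow lo B B'
    ag' e lt = ag e (NP.m<n⇒m<1+n (NP.<-≤-trans lt le))
    l' : lookup B' ℓ ≡ true
    l' = trans (sym (ag ℓ (NP.n<1+n _))) l
    g' : Gap B' lo (toℕ ℓ)
    g' e l1 l2 = trans (sym (ag e (NP.m<n⇒m<1+n l2))) (gB e l1 l2)

  basis-through-child₀Z : ∀ m {u lo B ℓ a b} → PrefixZ u lo B → Reach D u → n ≤ suc m + rk D u →
    kind D u ≡ inner ℓ a b → lo ≤ toℕ ℓ → Gap B lo (toℕ ℓ) → kind D a ≢ bot →
    Σ (Subset n) λ B' → IsBasis M B' × ℓ ∉ B' × (∀ e → toℕ e < toℕ ℓ → lookup B' e ≡ lookup B e)
  basis-through-child₀Z m {u} {lo} {B} {ℓ} {a} pref r h k leℓ gB ka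
    with accepts-some m a (reach-0 r k) (budget-step (subst (λ w → n ≤ suc m + w) (rank-inner k) h) lta) ka
    where lta = proj₁ (o _ _ _ _ r k)
  ... | C , accC = B' , basis , lookup⇒∉ ℓ∉B' , agree
    where
    lta = proj₁ (o _ _ _ _ r k)
    B' = splice (suc (toℕ ℓ)) (B [ ℓ ]≔ false) C
    ℓ∉B' : lookup B' ℓ ≡ false
    ℓ∉B' = trans (splice-below (suc (toℕ ℓ)) _ C ℓ (NP.n<1+n _)) (lookup-≔ B ℓ false)
    agree : ∀ e → toℕ e < toℕ ℓ → lookup B' e ≡ lookup B e
    agree e lt = trans (splice-below (suc (toℕ ℓ)) _ C e (NP.m<n⇒m<1+n lt))
                       (lookup-≔-other B false (toℕ≢⇒≢ (NP.<⇒≢ lt)))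
    accB' : ZAcc D B' lo u
    accB' = z0 k leℓ (λ e l1 l2 → trans (agree e l2) (gB e l1 l2)) ℓ∉B'
              (zacc-local (λ e le → sym (splice-from _ _ C e le)) (zacc-raise accC z≤n lta))
    basis : IsBasis M B'
    basis = proj₁ (sem B') (proj₂ (pref B' (λ e lt → sym (agree e (NP.<-≤-trans lt leℓ)))) accB')

  downZ : ∀ m u lo X B → Reach D u → n ≤ m + rk D u → lo ≤ rk D u → IsBasis M B → X ⊆ B →
    PrefixZ u lo B → ZAcc U X lo u
  downZ m u lo X B r h hl bB X⊆B pref with kind-view D u
  ... | inj₁ k = zend (update-top k) (λ e le → ⊆-lookup-false X⊆B (zacc-top k accB e le))
    where accB = proj₁ (pref B (λ _ _ → refl)) (proj₂ (sem B) bB)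
  ... | inj₂ (inj₁ k) = ⊥-elim (zacc-bot k (proj₁ (pref B (λ _ _ → refl)) (proj₂ (sem B) bB)))
  downZ zero u lo X B r h hl bB X⊆B pref | inj₂ (inj₂ (ℓ , a , b , k)) =
    ⊥-elim (no-inner-without-budget h k)
  downZ (suc m) u lo X B r h hl bB X⊆B pref | inj₂ (inj₂ (ℓ , a , b , k)) = go (lookup X ℓ) refl
    where
    h' = subst (λ w → n ≤ suc m + w) (rank-inner k) h
    ra = reach-0 r k
    rb = reach-1 r k
    lta = proj₁ (o _ _ _ _ r k)
    ltb = proj₂ (o _ _ _ _ r k)
    ha = budget-step h' lta
    hb = budget-step h' ltb
    accB : ZAcc D B lo u
    accB = proj₁ (pref B (λ _ _ → refl)) (proj₂ (sem B) bB)
    leℓ : lo ≤ toℕ ℓ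
    leℓ = proj₁ (zacc-inv k accB)
    gB : Gap B lo (toℕ ℓ)
    gB = proj₁ (proj₂ (zacc-inv k accB))
    gX : Gap X lo (toℕ ℓ)
    gX e l1 l2 = ⊆-lookup-false X⊆B (gB e l1 l2)
    go : ∀ v → lookup X ℓ ≡ v → ZAcc U X lo u
    go true lX with update-inner k
    ... | inj₁ (_ , kU) = z1 kU leℓ gX lX (downZ m b (suc (toℕ ℓ)) X B rb hb ltb bB X⊆B
                            (prefixZ-child₁ {B = B} pref k leℓ gB (∈⇒lookup (X⊆B (lookup⇒∈ lX)))))
    ... | inj₂ (_ , kU) = z1 kU leℓ gX lX (downZ m b (suc (toℕ ℓ)) X B rb hb ltb bB X⊆B
                            (prefixZ-child₁ {B = B} pref k leℓ gB (∈⇒lookup (X⊆B (lookup⇒∈ lX)))))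
    go false lX = go₀ (lookup B ℓ) refl (update-inner k)
      where
      go₀ : ∀ w → lookup B ℓ ≡ w → _ → ZAcc U X lo u
      go₀ false lB (inj₁ (ka , _)) = ⊥-elim (zacc-bot ka (zacc-inv0 k accB lB))
      go₀ false lB (inj₂ (_ , kU)) =
        z0 kU leℓ gX lX (downZ m a (suc (toℕ ℓ)) X B ra ha lta bB X⊆B
                           (prefixZ-child₀ {B = B} pref k leℓ gB lB))
      go₀ true lB (inj₁ (_ , kU)) =
        z0 kU leℓ gX lX (downZ m b (suc (toℕ ℓ)) X B rb hb ltb bB X⊆B
                           (prefixZ-child₁ {B = B} pref k leℓ gB lB))
      go₀ true lB (inj₂ (ka , kU)) with basis-through-child₀Z m {B = B} pref r h k leℓ gB ka
      ... | B' , bB' , ℓ∉B' , agree' with exchange-above bB bB' (lookup⇒∈ lB) ℓ∉B' agree'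
      ...   | B₂ , bB₂ , ℓ∉B₂ , B₋⊆B₂ , agree₂ =
        z0 kU leℓ gX lX (downZ m a (suc (toℕ ℓ)) X B₂ ra ha lta bB₂ (λ z → B₋⊆B₂ (⊆-≔false X⊆B lX z))
          (prefixZ-child₀ {B = B₂}
            (prefixZ-≈ {B = B} {B2 = B₂} pref (λ e lt → sym (agree₂ e (NP.<-≤-trans lt leℓ))))
            k leℓ (λ e l1 l2 → trans (agree₂ e l2) (gB e l1 l2)) ℓ∉B₂))

  completeZ : ∀ {X} → Indep M X → ZAcc U X 0 (root D)
  completeZ {X} iX with extend-to-basis iX
  ... | B , bB , X⊆B =
    downZ n (root D) 0 X B reach-root (NP.m≤m+n n _) z≤n bB X⊆B (λ B' _ → (λ z → z) , (λ z → z))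

  reach⇒prefixZ : ∀ {x} → Reach D x → Σ ℕ λ lo → Σ (Subset n) λ σ → lo ≤ rk D x × PrefixZ x lo σ
  reach⇒prefixZ reach-root = 0 , ∅ , z≤n , (λ B' _ → (λ z → z) , (λ z → z))
  reach⇒prefixZ (reach-0 {x} {ℓ} {a} {b} r k) with reach⇒prefixZ r
  ... | lo , σ , le , p = suc (toℕ ℓ) , σ' , proj₁ (o _ _ _ _ r k) ,
        prefixZ-child₀ {x} {lo} {σ'} {ℓ} {a} {b} (prefixZ-≈ {x} {lo} {σ} {σ'} p ag) k le' gp lσ
    where
    σ' = splice lo σ ∅
    le' = subst (lo ≤_) (rank-inner k) le
    ag : AgreeBelow lo σ σ'
    ag e lt = sym (splice-below lo σ ∅ e lt)
    gp : Gap σ' lo (toℕ ℓ)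
    gp e l1 _ = trans (splice-from lo σ ∅ e l1) (lookup-∅ e)
    lσ : lookup σ' ℓ ≡ false
    lσ = trans (splice-from lo σ ∅ ℓ le') (lookup-∅ ℓ)
  reach⇒prefixZ (reach-1 {x} {ℓ} {a} {b} r k) with reach⇒prefixZ r
  ... | lo , σ , le , p = suc (toℕ ℓ) , σ' , proj₂ (o _ _ _ _ r k) ,
        prefixZ-child₁ {x} {lo} {σ'} {ℓ} {a} {b} (prefixZ-≈ {x} {lo} {σ} {σ'} p ag) k le' gp lσ
    where
    σ' = splice lo σ (∅ [ ℓ ]≔ true)
    le' = subst (lo ≤_) (rank-inner k) le
    ag : AgreeBelow lo σ σ'
    ag e lt = sym (splice-below lo σ _ e lt)
    gp : Gap σ' lo (toℕ ℓ)
    gp e l1 l2 = trans (splice-from lo σ _ e l1)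
                       (trans (lookup-≔-other ∅ true (toℕ≢⇒≢ (λ eq → NP.<-irrefl eq l2))) (lookup-∅ e))
    lσ : lookup σ' ℓ ≡ true
    lσ = trans (splice-from lo σ _ ℓ le') (lookup-≔ ∅ ℓ true)

  -- If ν₀ = ν₁, a set accepted from the child, completed by the prefix of ν, is a basis both
  -- with and without ℓ(ν), against maximality.
  no-duplicate-children : ∀ {v ℓ b} → Reach D v → kind D v ≡ inner ℓ b b → Empty
  no-duplicate-children {v} {ℓ} {b} rv k with reach⇒prefixZ rv
  ... | lo , σ , le , p with accepts-some n b rb (NP.m≤m+n n _) (proj₂ (proj₂ R) v ℓ b b rv k)
    where rb = reach-1 rv k
  ... | C , accC = bool-clash (trans (sym (cong (λ z → lookup z ℓ) X1≡X0)) (lXv true)) (lXv false)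
    where
    ltb = proj₂ (o _ _ _ _ rv k)
    le' = subst (lo ≤_) (rank-inner k) le
    Xv : Bool → Subset n
    Xv w = splice lo σ (C [ ℓ ]≔ w)
    lXv : ∀ w → lookup (Xv w) ℓ ≡ w
    lXv w = trans (splice-from lo σ _ ℓ le') (lookup-≔ C ℓ w)
    gp : ∀ w → Gap (Xv w) lo (toℕ ℓ)
    gp w e l1 l2 = trans (splice-from lo σ _ e l1)
                         (trans (lookup-≔-other C w (toℕ≢⇒≢ (λ eq → NP.<-irrefl eq l2)))
                                (zacc-gap accC e z≤n (NP.<-trans l2 ltb)))
    ag : ∀ w → AgreeFrom (suc (toℕ ℓ)) C (Xv w)
    ag w e l' = sym (trans (splice-from lo σ _ e (NP.≤-trans le' (NP.≤-trans (NP.n≤1+n _) l')))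
                           (lookup-≔-other C w (toℕ≢⇒≢ (λ eq → NP.<-irrefl (sym eq) l'))))
    accB : ∀ w → ZAcc D (Xv w) (suc (toℕ ℓ)) b
    accB w = zacc-local (ag w) (zacc-raise accC z≤n ltb)
    acc0 : ZAcc D (Xv false) lo v
    acc0 = z0 k le' (gp false) (lXv false) (accB false)
    acc1 : ZAcc D (Xv true) lo v
    acc1 = z1 k le' (gp true) (lXv true) (accB true)
    agσ : ∀ w → AgreeBelow lo σ (Xv w)
    agσ w e lt = sym (splice-below lo σ _ e lt)
    b0 = proj₁ (sem (Xv false)) (proj₂ (p (Xv false) (agσ false)) acc0)
    b1 = proj₁ (sem (Xv true)) (proj₂ (p (Xv true) (agσ true)) acc1)
    same : ∀ e → e ≢ ℓ → lookup (Xv false) e ≡ lookup (Xv true) e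
    same e ne with toℕ e <? lo
    ... | yes lt = trans (splice-below lo σ _ e lt) (sym (splice-below lo σ _ e lt))
    ... | no nlt = trans (splice-from lo σ _ e (NP.≮⇒≥ nlt)) (trans (lookup-≔-other C false ne)
                   (sym (trans (splice-from lo σ _ e (NP.≮⇒≥ nlt)) (lookup-≔-other C true ne))))
    X0⊆X1 : Xv false ⊆ Xv true
    X0⊆X1 {e} mm with e FP.≟ ℓ
    ... | yes refl = ⊥-elim (bool-clash (∈⇒lookup mm) (lXv false))
    ... | no ne = lookup⇒∈ {X = Xv true} (trans (sym (same e ne)) (∈⇒lookup mm))
    X1≡X0 : Xv true ≡ Xv false
    X1≡X0 = proj₂ b0 (Xv true) (proj₁ b1) X0⊆X1

  -- Nodes that are both updated or both unchanged were already merged by (NS); an updated node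
  -- ν ↦ (ν₁, ν₁) coinciding with an unchanged one would give a node with equal children.
  update-NSFree : NSFree U
  update-NSFree u v ℓ a b ru' rv' ku kv
    with reach-update⁻ ru' | reach-update⁻ rv' | update-inner⁻ ku | update-inner⁻ kv
  ... | ru | rv | a₁ , k₁ , inj₁ (ka₁ , refl) | a₂ , k₂ , inj₁ (ka₂ , _)
    with bot-unique {D = D} (proj₁ R) a₁ a₂ (reach-0 ru k₁) (reach-0 rv k₂) ka₁ ka₂
  ...   | refl = proj₁ (proj₂ R) u v ℓ a₁ b ru rv k₁ k₂
  update-NSFree u v ℓ a b ru' rv' ku kv | ru | rv | _ , k₁ , inj₂ (_ , refl) | _ , k₂ , inj₂ (_ , refl) =
    proj₁ (proj₂ R) u v ℓ a b ru rv k₁ k₂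
  update-NSFree u v ℓ a b ru' rv' ku kv | ru | rv | _ , k₁ , inj₁ (_ , refl) | _ , k₂ , inj₂ (_ , refl) =
    ⊥-elim (no-duplicate-children rv k₂)
  update-NSFree u v ℓ a b ru' rv' ku kv | ru | rv | _ , k₁ , inj₂ (_ , refl) | _ , k₂ , inj₁ (_ , refl) =
    ⊥-elim (no-duplicate-children ru k₁)

  update-ZNDFree : ZNDFree U
  update-ZNDFree ν ℓ a' b' rν k kb with update-inner⁻ k
  ... | a , k' , _ = proj₂ (proj₂ R) ν ℓ a b' (reach-update⁻ rν) k' (update-bot⁻ kb)

ZAccepts : ∀ {n} → Diagram n → (Subset n → Set) → Set
ZAccepts D P = ∀ X → (ZAcc D X 0 (root D) → P X) × (P X → ZAcc D X 0 (root D))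

ZDD-accepts : ∀ {n} {D : Diagram n} {S : Family n} → IsZDDOf D S → ZReduced D × ZAccepts D (Mem S)
ZDD-accepts {S = S} (steps , nsf , zndf) with ZSteps-sound steps (CompleteTree.tree-wellFormed S)
... | wf , equiv = (wf , nsf , zndf) ,
  λ X → (λ acc → proj₁ (CompleteTreeZ.tree-ZSem S X) (proj₂ (equiv X) acc)) ,
        (λ m → proj₁ (equiv X) (proj₂ (CompleteTreeZ.tree-ZSem S X) m))

ZAccepts⇒ZEquiv : ∀ {n} {D1 D2 : Diagram n} {P : Subset n → Set} → ZAccepts D1 P → ZAccepts D2 P →
  ZEquiv D1 (root D1) D2 (root D2)
ZAccepts⇒ZEquiv sem1 sem2 X = (λ acc → proj₂ (sem2 X) (proj₁ (sem1 X) acc)) ,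
                              (λ acc → proj₂ (sem1 X) (proj₁ (sem2 X) acc))

ZAccepts⇒ZRepresents : ∀ {n} {D : Diagram n} {S : Family n} → WellFormed D → ZAccepts D (Mem S) →
  ZRepresents D S
ZAccepts⇒ZRepresents {D = D} wf sem X =
  (λ s → proj₁ (sem X) (zsem→zacc (ordered {D = D} wf) s)) , (λ m → zacc→zsem (proj₂ (sem X) m))

zdd-update-theorem : (n : ℕ) (M : Matroid n) (basis? : Decidable (IsBasis M)) →
  (D₀ : Diagram n) → IsZDDOf D₀ (bases M basis?) →
  ZRepresents (update D₀) (independentSets M) × NSFree (update D₀) × ZNDFree (update D₀) ×
  ((D' : Diagram n) → IsZDDOf D' (independentSets M) → update D₀ ≅ D')
zdd-update-theorem n M basis? D₀ isZDD₀ =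
  ZAccepts⇒ZRepresents {S = independentSets M} wfU semU , update-NSFree , update-ZNDFree , iso
  where
  R₀ = proj₁ (ZDD-accepts isZDD₀)
  open ZUpdate M D₀ R₀ (proj₂ (ZDD-accepts isZDD₀))
  wfU = Update.update-wellFormed D₀ (proj₁ R₀)
  semU : ZAccepts (update D₀) (Indep M)
  semU X = soundZ , completeZ
  iso : (D' : Diagram n) → IsZDDOf D' (independentSets M) → update D₀ ≅ D'
  iso D' isZDD' = ZDD-canonical (update D₀) D' (wfU , update-NSFree , update-ZNDFree) (proj₁ (ZDD-accepts isZDD'))
                    (ZAccepts⇒ZEquiv semU (proj₂ (ZDD-accepts isZDD')))

theorem3p5 : (n : ℕ) (M : Matroid n) (basis? : Decidable (IsBasis M)) →
    ((D₀ : Diagram n) → IsBDDOf D₀ (bases M basis?) →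
    (D : Diagram n) → Star BStep (update D₀) D → NSFree D → BNDFree D →
    BRepresents D (independentSets M) ×
    ((D' : Diagram n) → IsBDDOf D' (independentSets M) → D ≅ D')) ×
    ((D₀ : Diagram n) → IsZDDOf D₀ (bases M basis?) →
    ZRepresents (update D₀) (independentSets M) ×
    NSFree (update D₀) × ZNDFree (update D₀) ×
    ((D' : Diagram n) → IsZDDOf D' (independentSets M) → update D₀ ≅ D'))
theorem3p5 n M basis? = bdd-update-theorem n M basis? , zdd-update-theorem n M basis?
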